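{- Let $B(1;2,3,3;\ell,n)$ denote the number of partitions $\pi=(\pi_1,\dots,\pi_\ell)$ of $n$ with exactly $\ell$ parts such that no odd part is repeated, $\pi_i\ge\pi_{i+2}+2$ for $1\le i\le \ell-2$ with strict inequality if $\pi_i$ is even, and at most $2$ parts are less than or equal to $2$. Then \[\sum_{\ell,n\geq0}B(1;2,3,3;\ell,n)x^\ell q^n=\sum_{N_1\geq N_{2}\geq0}\frac{q^{2(N_1^2+N_{2}^2)}(-xq^{1+2N_2};q^2)_\infty\, x^{N_1+N_{2}}}{(q^2;q^2)_{N_1-N_2} (q^{2};q^{2})_{N_{2}}}.\]
   Context: $(a;q)_\infty=\prod_{i\ge0}(1-aq^i)$ and $(a;q)_n=(a;q)_\infty/(aq^n;q)_\infty$, with $|q|<1$ (or as formal power series). A partition is a finite non-increasing sequence of positive integers. -}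

module Defs where

open import Data.Nat as ℕ using (ℕ; zero; suc; _+_; _*_; _∸_; _≤_; _<_; _≤?_; _<?_)
open import Data.Nat.Divisibility using (_∣_; _∣?_)
open import Data.Fin as Fin using (Fin; toℕ)
open import Data.Fin.Properties using (all?)
open import Data.Vec as Vec using (Vec; []; _∷_; lookup; toList)
open import Data.List as List using (List; []; _∷_; length; filter; concatMap; upTo)
import Data.List as L
open import Data.Integer as ℤ using (ℤ; +_)
open import Data.Product using (_×_)
open import Relation.Binary.PropositionalEquality using (_≡_; _≢_)
open import Relation.Nullary using (Dec; yes; no; ¬?)
open import Relation.Nullary.Decidable using (_×-dec_; _→-dec_)

-- Left-hand side: the partition count B(1;2,3,3;ℓ,n)
-- A partition with exactly ℓ parts is a vector π : Vec ℕ ℓ,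
-- π = (π₁,…,π_ℓ) with index i : Fin ℓ standing for π_{i+1}.

IsPartitionOf : ∀ {ℓ} → ℕ → Vec ℕ ℓ → Set
IsPartitionOf n π =
  (∀ i → 1 ≤ lookup π i)
  × (∀ (i j : Fin _) → toℕ i < toℕ j → lookup π j ≤ lookup π i)
  × (Vec.sum π ≡ n)

BCond : ∀ {ℓ} → Vec ℕ ℓ → Set
BCond π =
  (∀ (i j : Fin _) → i ≢ j → lookup π i ≡ lookup π j → 2 ∣ lookup π i)
  × (∀ (i j : Fin _) → toℕ j ≡ toℕ i + 2 →
       (lookup π j + 2 ≤ lookup π i) × (2 ∣ lookup π i → lookup π j + 2 < lookup π i))
  × (length (filter (_≤? 2) (toList π)) ≤ 2)

IsB : ∀ {ℓ} → ℕ → Vec ℕ ℓ → Set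
IsB n π = IsPartitionOf n π × BCond π

isB? : ∀ {ℓ} (n : ℕ) (π : Vec ℕ ℓ) → Dec (IsB n π)
isB? n π =
  ((all? λ i → 1 ≤? lookup π i)
   ×-dec (all? λ i → all? λ j → (toℕ i <? toℕ j) →-dec (lookup π j ≤? lookup π i))
   ×-dec (Vec.sum π ℕ.≟ n))
  ×-dec
  ((all? λ i → all? λ j → ¬? (i Fin.≟ j) →-dec ((lookup π i ℕ.≟ lookup π j) →-dec (2 ∣? lookup π i)))
   ×-dec (all? λ i → all? λ j → (toℕ j ℕ.≟ toℕ i + 2) →-dec
            ((lookup π j + 2 ≤? lookup π i) ×-dec ((2 ∣? lookup π i) →-dec (lookup π j + 2 <? lookup π i))))
   ×-dec (length (filter (_≤? 2) (toList π)) ≤? 2))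

vecsUpTo : (ℓ m : ℕ) → List (Vec ℕ ℓ)
vecsUpTo zero    m = [] ∷ []
vecsUpTo (suc ℓ) m = concatMap (λ k → L.map (k ∷_) (vecsUpTo ℓ m)) (upTo (suc m))

-- B(1;2,3,3;ℓ,n): every part of a partition of n is ≤ n, so all
-- candidates occur (exactly once) in vecsUpTo ℓ n.
B : ℕ → ℕ → ℕ
B ℓ n = length (filter (isB? n) (vecsUpTo ℓ n))

-- Formal power series in x and q with integer coefficients:
-- s a b = coefficient of x^a q^b.

Series : Set
Series = ℕ → ℕ → ℤ

Σ≤ : ℕ → (ℕ → ℤ) → ℤ
Σ≤ zero    f = f 0
Σ≤ (suc n) f = Σ≤ n f ℤ.+ f (suc n)

_⊕_ : Series → Series → Series
(f ⊕ g) a b = f a b ℤ.+ g a b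

_⊖_ : Series → Series → Series
(f ⊖ g) a b = f a b ℤ.- g a b

_⊗_ : Series → Series → Series
(f ⊗ g) a b = Σ≤ a λ i → Σ≤ b λ j → f i j ℤ.* g (a ∸ i) (b ∸ j)

infixl 7 _⊗_
infixl 6 _⊕_ _⊖_

mono : ℤ → ℕ → ℕ → Series
mono c i j a b with a ℕ.≟ i | b ℕ.≟ j
... | yes _ | yes _ = c
... | _         | _         = + 0

one : Series
one = mono (+ 1) 0 0

_^ˢ_ : Series → ℕ → Series
f ^ˢ zero  = one
f ^ˢ suc k = f ⊗ (f ^ˢ k)

Π< : ℕ → (ℕ → Series) → Series
Π< zero    f = one
Π< (suc k) f = Π< k f ⊗ f k

q2poch : ℕ → Series
q2poch N = Π< N λ i → one ⊖ mono (+ 1) 0 (2 + 2 * i)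

-- Formal inverse 1/p of a series p with constant term 1:
-- 1/p = 1/(1-m) = Σ_k m^k with m = 1 - p (no constant term); the
-- coefficient of x^a q^b only receives contributions from k ≤ a + b.
recip : Series → Series
recip p a b = Σ≤ (a + b) λ k → ((one ⊖ p) ^ˢ k) a b

-- (-x q^c; q²)_∞ = ∏_{i≥0} (1 + x q^{c+2i}), c ≥ 1; the coefficient of
-- q^b only receives contributions from the factors with i ≤ b.
negxPochInf : ℕ → Series
negxPochInf c a b = (Π< (suc b) λ i → one ⊕ mono (+ 1) 1 (c + 2 * i)) a b

term : ℕ → ℕ → Series
term N₁ N₂ =
  mono (+ 1) (N₁ + N₂) (2 * (N₁ * N₁ + N₂ * N₂))
  ⊗ negxPochInf (1 + 2 * N₂)
  ⊗ recip (q2poch (N₁ ∸ N₂))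
  ⊗ recip (q2poch N₂)

-- Σ_{N₁ ≥ N₂ ≥ 0} term N₁ N₂; the summand carries x^{N₁+N₂} times series
-- in nonnegative powers of x, so only N₁ ≤ a contributes to x^a.
RHS : Series
RHS a b = Σ≤ a λ N₁ → Σ≤ N₁ λ N₂ → term N₁ N₂ a b

{-# OPTIONS --safe #-}
-- Write F = Σ B(1;2,3,3;ℓ,n) xˡ qⁿ and σ for the substitution x ↦ xq².  Building a partition from
-- its smallest part upwards is a finite-state recursion whose state records the last two parts
-- placed; let D be the same count started as if a part 1 had already been placed.  Comparing the
-- admissible choices for the smallest part gives
--   F = D + xq D + x²q⁴ σ²F,   D = σF + xq² σD + x²q⁵ σ²F,   F(0) = D(0) = 1,
-- a system with a unique solution, since it determines the coefficients row by row in x.  The series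
--   R(a,b,c) = Σ_{N₁≥N₂≥0} x^(N₁+N₂) q^(2N₁²+2N₂²+aN₁+bN₂) (-xq^(1+c+2N₂);q²)_∞
--                                                   / ((q²;q²)_(N₁-N₂) (q²;q²)_N₂)
-- satisfy σR(a,b,c) = R(a+2,b+2,c+2) and three recurrences, coming from
-- (-xq^c;q²)_∞ = (1 + xq^c)(-xq^(c+2);q²)_∞ and from (1 - q^2N)/(q²;q²)_N = 1/(q²;q²)_(N-1) in either
-- denominator.  Combining them shows that R(0,0,0), the right-hand side, and R(0,2,2) solve the same system.
module Submission where

open import Defs
open import Algebra.Bundles using (CommutativeMonoid)
open import Data.Bool using (Bool; true; false; _∧_; _∨_; not; if_then_else_; T)
import Data.Bool.Properties as Boolₚ
open import Data.Empty using (⊥; ⊥-elim)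
open import Data.Fin using (Fin; zero; suc; toℕ)
import Data.Fin.Properties as Finₚ
open import Data.Integer as ℤ using (ℤ; +_; 0ℤ; 1ℤ)
import Data.Integer.Properties as ℤₚ
open import Data.Integer.Tactic.RingSolver using (solve-∀)
open import Data.List as List using (List; []; _∷_; _++_; length; filter; concatMap; applyUpTo)
import Data.List.Properties as Listₚ
open import Data.Nat as ℕ using (ℕ; zero; suc; _+_; _*_; _∸_; _≤_; _<_; z≤n; s≤s; _≤?_; _<ᵇ_; _≡ᵇ_)
open import Data.Nat.Divisibility using (_∣_; divides)
open import Data.Nat.Induction using (<-rec)
import Data.Nat.Properties as ℕₚ
import Data.Nat.Tactic.RingSolver as ℕ-Solver
open import Data.Product using (_×_; _,_; proj₁; proj₂)
open import Data.Sum using (_⊎_; inj₁; inj₂; map₁)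
open import Data.Unit using (tt)
open import Data.Vec as Vec using (Vec; []; _∷_; _∷ʳ_; lookup; toList)
open import Function using (_∘_; id; _⇔_; mk⇔; Equivalence)
open import Relation.Binary.Bundles using (Setoid)
open import Relation.Binary.PropositionalEquality
open import Relation.Nullary using (¬_; Dec; yes; no; does; proof)
import Relation.Nullary.Reflects as Reflects
open import Algebra.Properties.AbelianGroup ℤₚ.+-0-abelianGroup using () renaming (∙-cancelʳ to +-cancelʳ)
open import Algebra.Properties.CommutativeSemigroup ℕₚ.+-commutativeSemigroup using (x∙yz≈y∙xz)
import Algebra.Solver.CommutativeMonoid
import Relation.Binary.Reasoning.Setoid

*-vanishˡ : ∀ {u} v → u ≡ 0ℤ → u ℤ.* v ≡ 0ℤ
*-vanishˡ v refl = ℤₚ.*-zeroˡ v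

*-vanishʳ : ∀ u {v} → v ≡ 0ℤ → u ℤ.* v ≡ 0ℤ
*-vanishʳ u refl = ℤₚ.*-zeroʳ u

*-distribʳ-- : ∀ x y z → (y ℤ.- z) ℤ.* x ≡ y ℤ.* x ℤ.- z ℤ.* x
*-distribʳ-- = solve-∀

difference⇒sum : ∀ {x y z} → x ℤ.- y ≡ z → x ≡ y ℤ.+ z
difference⇒sum {x} {y} refl = split x y
  where
  split : ∀ x y → x ≡ y ℤ.+ (x ℤ.- y)
  split = solve-∀

-- Finite sums

Σ≤-cong-≤ : ∀ n {f g : ℕ → ℤ} → (∀ i → i ≤ n → f i ≡ g i) → Σ≤ n f ≡ Σ≤ n g
Σ≤-cong-≤ zero    f≡g = f≡g 0 z≤n
Σ≤-cong-≤ (suc n) f≡g =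
  cong₂ ℤ._+_ (Σ≤-cong-≤ n (λ i i≤n → f≡g i (ℕₚ.m≤n⇒m≤1+n i≤n))) (f≡g (suc n) ℕₚ.≤-refl)

Σ≤-cong : ∀ n {f g : ℕ → ℤ} → (∀ i → f i ≡ g i) → Σ≤ n f ≡ Σ≤ n g
Σ≤-cong n f≡g = Σ≤-cong-≤ n (λ i _ → f≡g i)

Σ≤-zero : ∀ n {f : ℕ → ℤ} → (∀ i → i ≤ n → f i ≡ 0ℤ) → Σ≤ n f ≡ 0ℤ
Σ≤-zero zero    f≡0 = f≡0 0 z≤n
Σ≤-zero (suc n) f≡0 =
  cong₂ ℤ._+_ (Σ≤-zero n (λ i i≤n → f≡0 i (ℕₚ.m≤n⇒m≤1+n i≤n))) (f≡0 (suc n) ℕₚ.≤-refl)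

Σ≤-distrib-+ : ∀ n (f g : ℕ → ℤ) → Σ≤ n (λ i → f i ℤ.+ g i) ≡ Σ≤ n f ℤ.+ Σ≤ n g
Σ≤-distrib-+ zero    f g = refl
Σ≤-distrib-+ (suc n) f g =
  trans (cong (ℤ._+ (f (suc n) ℤ.+ g (suc n))) (Σ≤-distrib-+ n f g))
        (interchange (Σ≤ n f) (Σ≤ n g) (f (suc n)) (g (suc n)))
  where
  interchange : ∀ a b c d → a ℤ.+ b ℤ.+ (c ℤ.+ d) ≡ a ℤ.+ c ℤ.+ (b ℤ.+ d)
  interchange = solve-∀

Σ≤-distrib-neg : ∀ n (f : ℕ → ℤ) → Σ≤ n (λ i → ℤ.- f i) ≡ ℤ.- Σ≤ n f
Σ≤-distrib-neg zero    f = refl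
Σ≤-distrib-neg (suc n) f =
  trans (cong (ℤ._+ ℤ.- f (suc n)) (Σ≤-distrib-neg n f)) (sym (ℤₚ.neg-distrib-+ (Σ≤ n f) (f (suc n))))

Σ≤-distrib-- : ∀ n (f g : ℕ → ℤ) → Σ≤ n (λ i → f i ℤ.- g i) ≡ Σ≤ n f ℤ.- Σ≤ n g
Σ≤-distrib-- n f g = trans (Σ≤-distrib-+ n f (ℤ.-_ ∘ g)) (cong (λ s → Σ≤ n f ℤ.+ s) (Σ≤-distrib-neg n g))

*-distribˡ-Σ≤ : ∀ n c (f : ℕ → ℤ) → c ℤ.* Σ≤ n f ≡ Σ≤ n (λ i → c ℤ.* f i)
*-distribˡ-Σ≤ zero    c f = refl
*-distribˡ-Σ≤ (suc n) c f =
  trans (ℤₚ.*-distribˡ-+ c (Σ≤ n f) (f (suc n))) (cong (ℤ._+ c ℤ.* f (suc n)) (*-distribˡ-Σ≤ n c f))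

*-distribʳ-Σ≤ : ∀ n c (f : ℕ → ℤ) → Σ≤ n f ℤ.* c ≡ Σ≤ n (λ i → f i ℤ.* c)
*-distribʳ-Σ≤ zero    c f = refl
*-distribʳ-Σ≤ (suc n) c f =
  trans (ℤₚ.*-distribʳ-+ c (Σ≤ n f) (f (suc n))) (cong (ℤ._+ f (suc n) ℤ.* c) (*-distribʳ-Σ≤ n c f))

Σ≤-comm : ∀ m n (f : ℕ → ℕ → ℤ) → Σ≤ m (λ i → Σ≤ n (f i)) ≡ Σ≤ n (λ j → Σ≤ m (λ i → f i j))
Σ≤-comm zero    n f = refl
Σ≤-comm (suc m) n f =
  trans (cong (ℤ._+ Σ≤ n (f (suc m))) (Σ≤-comm m n f)) (sym (Σ≤-distrib-+ n (λ j → Σ≤ m (λ i → f i j)) (f (suc m))))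

Σ≤-suc : ∀ n (f : ℕ → ℤ) → Σ≤ (suc n) f ≡ f 0 ℤ.+ Σ≤ n (f ∘ suc)
Σ≤-suc zero    f = refl
Σ≤-suc (suc n) f = trans (cong (ℤ._+ f (2 + n)) (Σ≤-suc n f)) (ℤₚ.+-assoc (f 0) _ _)

Σ≤-extend : ∀ {m n} (f : ℕ → ℤ) → n ≤ m → (∀ i → n < i → i ≤ m → f i ≡ 0ℤ) → Σ≤ m f ≡ Σ≤ n f
Σ≤-extend {m} {n} f n≤m f≡0 with ℕₚ.m≤n⇒m<n∨m≡n n≤m
... | inj₂ refl = refl
... | inj₁ (s≤s {n = m′} n≤m′) =
  trans (cong (λ s → Σ≤ m′ f ℤ.+ s) (f≡0 (suc m′) (s≤s n≤m′) ℕₚ.≤-refl))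
    (trans (ℤₚ.+-identityʳ _) (Σ≤-extend f n≤m′ (λ i n<i i≤m′ → f≡0 i n<i (ℕₚ.m≤n⇒m≤1+n i≤m′))))

Σ≤-single : ∀ n k (f : ℕ → ℤ) → k ≤ n → (∀ i → i ≢ k → f i ≡ 0ℤ) → Σ≤ n f ≡ f k
Σ≤-single zero    .zero f z≤n f≡0 = refl
Σ≤-single (suc n) k     f k≤n f≡0 with k ℕ.≟ suc n
... | yes refl =
  trans (cong (ℤ._+ f (suc n)) (Σ≤-zero n (λ i i≤n → f≡0 i (ℕₚ.<⇒≢ (s≤s i≤n))))) (ℤₚ.+-identityˡ _)
... | no  k≢   = trans (cong (λ s → Σ≤ n f ℤ.+ s) (f≡0 (suc n) (k≢ ∘ sym)))
                   (trans (ℤₚ.+-identityʳ _) (Σ≤-single n k f (ℕₚ.≤-pred (ℕₚ.≤∧≢⇒< k≤n k≢)) f≡0))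

Σ≤-telescope : ∀ n (g : ℕ → ℤ) → Σ≤ n (λ k → g k ℤ.- g (suc k)) ≡ g 0 ℤ.- g (suc n)
Σ≤-telescope zero    g = refl
Σ≤-telescope (suc n) g = trans (cong (ℤ._+ (g (suc n) ℤ.- g (2 + n))) (Σ≤-telescope n g)) (collapse (g 0) (g (suc n)) (g (2 + n)))
  where
  collapse : ∀ a b c → a ℤ.- b ℤ.+ (b ℤ.- c) ≡ a ℤ.- c
  collapse = solve-∀

Σ≤-reverse : ∀ n (f : ℕ → ℤ) → Σ≤ n f ≡ Σ≤ n (λ i → f (n ∸ i))
Σ≤-reverse zero    f = refl
Σ≤-reverse (suc n) f = begin
  Σ≤ (suc n) f                                    ≡⟨ Σ≤-suc n f ⟩
  f 0 ℤ.+ Σ≤ n (f ∘ suc)                          ≡⟨ cong (λ s → f 0 ℤ.+ s) (Σ≤-reverse n (f ∘ suc)) ⟩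
  f 0 ℤ.+ Σ≤ n (λ i → f (suc (n ∸ i)))            ≡⟨ ℤₚ.+-comm (f 0) _ ⟩
  Σ≤ n (λ i → f (suc (n ∸ i))) ℤ.+ f 0
    ≡⟨ cong₂ ℤ._+_ (Σ≤-cong-≤ n λ i i≤n → cong f (sym (ℕₚ.+-∸-assoc 1 i≤n)))
                   (cong f (sym (ℕₚ.n∸n≡0 n))) ⟩
  Σ≤ n (λ i → f (suc n ∸ i)) ℤ.+ f (n ∸ n)        ∎
  where open ≡-Reasoning

Σ≤-triangle : ∀ n (φ : ℕ → ℕ → ℤ) →
              Σ≤ n (λ i → Σ≤ i (λ k → φ k (i ∸ k))) ≡ Σ≤ n (λ k → Σ≤ (n ∸ k) (φ k))
Σ≤-triangle zero    φ = refl
Σ≤-triangle (suc n) φ = begin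
  Σ≤ n (λ i → Σ≤ i (λ k → φ k (i ∸ k))) ℤ.+ (Σ≤ n (λ k → φ k (suc n ∸ k)) ℤ.+ φ (suc n) (n ∸ n))
    ≡⟨ cong₂ (λ s t → s ℤ.+ (Σ≤ n (λ k → φ k (suc n ∸ k)) ℤ.+ φ (suc n) t))
             (Σ≤-triangle n φ) (ℕₚ.n∸n≡0 n) ⟩
  Σ≤ n (λ k → Σ≤ (n ∸ k) (φ k)) ℤ.+ (Σ≤ n (λ k → φ k (suc n ∸ k)) ℤ.+ φ (suc n) 0)
    ≡⟨ sym (ℤₚ.+-assoc (Σ≤ n (λ k → Σ≤ (n ∸ k) (φ k))) (Σ≤ n (λ k → φ k (suc n ∸ k))) _) ⟩
  Σ≤ n (λ k → Σ≤ (n ∸ k) (φ k)) ℤ.+ Σ≤ n (λ k → φ k (suc n ∸ k)) ℤ.+ φ (suc n) 0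
    ≡⟨ cong (ℤ._+ φ (suc n) 0) (sym (Σ≤-distrib-+ n _ _)) ⟩
  Σ≤ n (λ k → Σ≤ (n ∸ k) (φ k) ℤ.+ φ k (suc n ∸ k)) ℤ.+ φ (suc n) 0
    ≡⟨ cong₂ ℤ._+_ (Σ≤-cong-≤ n λ k k≤n → unfold-last (ℕₚ.+-∸-assoc 1 k≤n))
                   (cong (λ m → Σ≤ m (φ (suc n))) (sym (ℕₚ.n∸n≡0 n))) ⟩
  Σ≤ n (λ k → Σ≤ (suc n ∸ k) (φ k)) ℤ.+ Σ≤ (n ∸ n) (φ (suc n))
    ∎
  where
  open ≡-Reasoning
  unfold-last : ∀ {k m} → suc n ∸ k ≡ suc m → Σ≤ m (φ k) ℤ.+ φ k (suc n ∸ k) ≡ Σ≤ (suc n ∸ k) (φ k)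
  unfold-last e rewrite e = refl

Σ≤-shift : ∀ k m (f : ℕ → ℤ) → (∀ i → i < k → f i ≡ 0ℤ) → Σ≤ (k + m) f ≡ Σ≤ m (λ j → f (k + j))
Σ≤-shift zero    m f f≡0 = refl
Σ≤-shift (suc k) m f f≡0 = begin
  Σ≤ (suc (k + m)) f                  ≡⟨ Σ≤-suc (k + m) f ⟩
  f 0 ℤ.+ Σ≤ (k + m) (f ∘ suc)
    ≡⟨ cong₂ ℤ._+_ (f≡0 0 (s≤s z≤n)) (Σ≤-shift k m (f ∘ suc) (λ i i<k → f≡0 (suc i) (s≤s i<k))) ⟩
  0ℤ ℤ.+ Σ≤ m (λ j → f (suc k + j))   ≡⟨ ℤₚ.+-identityˡ _ ⟩
  Σ≤ m (λ j → f (suc k + j))          ∎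
  where open ≡-Reasoning

Σ△ : ℕ → (ℕ → ℕ → ℤ) → ℤ
Σ△ n g = Σ≤ n λ i → Σ≤ i (g i)

Σ△-cong-≤ : ∀ n {g h : ℕ → ℕ → ℤ} → (∀ i j → j ≤ i → i ≤ n → g i j ≡ h i j) → Σ△ n g ≡ Σ△ n h
Σ△-cong-≤ n g≡h = Σ≤-cong-≤ n λ i i≤n → Σ≤-cong-≤ i λ j j≤i → g≡h i j j≤i i≤n

Σ△-cong : ∀ n {g h : ℕ → ℕ → ℤ} → (∀ i j → g i j ≡ h i j) → Σ△ n g ≡ Σ△ n h
Σ△-cong n g≡h = Σ△-cong-≤ n λ i j _ _ → g≡h i j

Σ△-distrib-+ : ∀ n (g h : ℕ → ℕ → ℤ) → Σ△ n (λ i j → g i j ℤ.+ h i j) ≡ Σ△ n g ℤ.+ Σ△ n h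
Σ△-distrib-+ n g h = trans (Σ≤-cong n λ i → Σ≤-distrib-+ i (g i) (h i)) (Σ≤-distrib-+ n _ _)

Σ△-distrib-- : ∀ n (g h : ℕ → ℕ → ℤ) → Σ△ n (λ i j → g i j ℤ.- h i j) ≡ Σ△ n g ℤ.- Σ△ n h
Σ△-distrib-- n g h = trans (Σ≤-cong n λ i → Σ≤-distrib-- i (g i) (h i)) (Σ≤-distrib-- n _ _)

Σ△-dropColumn : ∀ n (g : ℕ → ℕ → ℤ) → (∀ i → g i 0 ≡ 0ℤ) →
                Σ△ (suc n) g ≡ Σ△ n (λ i j → g (suc i) (suc j))
Σ△-dropColumn n g g₀≡0 = begin
  Σ≤ (suc n) (λ i → Σ≤ i (g i))                         ≡⟨ Σ≤-suc n _ ⟩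
  g 0 0 ℤ.+ Σ≤ n (λ i → Σ≤ (suc i) (g (suc i)))
    ≡⟨ cong₂ ℤ._+_ (g₀≡0 0) (Σ≤-cong n λ i → Σ≤-suc i (g (suc i))) ⟩
  0ℤ ℤ.+ Σ≤ n (λ i → g (suc i) 0 ℤ.+ Σ≤ i (g (suc i) ∘ suc))
    ≡⟨ trans (ℤₚ.+-identityˡ _) (Σ≤-cong n λ i →
         trans (cong (ℤ._+ Σ≤ i (g (suc i) ∘ suc)) (g₀≡0 (suc i))) (ℤₚ.+-identityˡ _)) ⟩
  Σ≤ n (λ i → Σ≤ i (g (suc i) ∘ suc))                   ∎
  where open ≡-Reasoning

Σ△-dropDiagonal : ∀ n (g : ℕ → ℕ → ℤ) → (∀ i → g i i ≡ 0ℤ) →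
                  Σ△ (suc n) g ≡ Σ△ n (λ i j → g (suc i) j)
Σ△-dropDiagonal n g gᵢᵢ≡0 = begin
  Σ≤ (suc n) (λ i → Σ≤ i (g i))                               ≡⟨ Σ≤-suc n _ ⟩
  g 0 0 ℤ.+ Σ≤ n (λ i → Σ≤ i (g (suc i)) ℤ.+ g (suc i) (suc i))
    ≡⟨ cong₂ ℤ._+_ (gᵢᵢ≡0 0) (Σ≤-cong n λ i →
         trans (cong (λ v → Σ≤ i (g (suc i)) ℤ.+ v) (gᵢᵢ≡0 (suc i))) (ℤₚ.+-identityʳ _)) ⟩
  0ℤ ℤ.+ Σ≤ n (λ i → Σ≤ i (g (suc i)))                        ≡⟨ ℤₚ.+-identityˡ _ ⟩
  Σ≤ n (λ i → Σ≤ i (g (suc i)))                               ∎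
  where open ≡-Reasoning

Σ△-zero : ∀ n {g : ℕ → ℕ → ℤ} → (∀ i j → g i j ≡ 0ℤ) → Σ△ n g ≡ 0ℤ
Σ△-zero n g≡0 = Σ≤-zero n λ i _ → Σ≤-zero i λ j _ → g≡0 i j

-- Power series in x and q

infix 4 _≈_
record _≈_ (f g : Series) : Set where
  field coeff : ∀ a b → f a b ≡ g a b
open _≈_ public

≈-refl : ∀ {f} → f ≈ f
≈-refl .coeff a b = refl

≈-sym : ∀ {f g} → f ≈ g → g ≈ f
≈-sym f≈g .coeff a b = sym (coeff f≈g a b)

≈-trans : ∀ {f g h} → f ≈ g → g ≈ h → f ≈ h
≈-trans f≈g g≈h .coeff a b = trans (coeff f≈g a b) (coeff g≈h a b)

≈-setoid : Setoid _ _
≈-setoid = record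
  { Carrier = Series ; _≈_ = _≈_
  ; isEquivalence = record { refl = λ {f} → ≈-refl {f} ; sym = ≈-sym ; trans = ≈-trans } }

module ≈-Reasoning = Relation.Binary.Reasoning.Setoid ≈-setoid

x^_q^_ : ℕ → ℕ → Series
x^ i q^ j = mono (+ 1) i j

mono-hit : ∀ c i j → mono c i j i j ≡ c
mono-hit c i j with i ℕ.≟ i | j ℕ.≟ j
... | yes _  | yes _  = refl
... | no i≢i | _      = ⊥-elim (i≢i refl)
... | yes _  | no j≢j = ⊥-elim (j≢j refl)

mono-miss : ∀ c i j a b → (a ≡ i → b ≡ j → ⊥) → mono c i j a b ≡ 0ℤ
mono-miss c i j a b ¬hit with a ℕ.≟ i | b ℕ.≟ j
... | yes a≡i | yes b≡j = ⊥-elim (¬hit a≡i b≡j)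
... | yes _   | no _    = refl
... | no _    | _       = refl

shift : ℕ → ℕ → Series → Series
shift i j f a b with i ≤? a | j ≤? b
... | yes _ | yes _ = f (a ∸ i) (b ∸ j)
... | _     | _     = 0ℤ

shift-yes : ∀ i j f {a b} → i ≤ a → j ≤ b → shift i j f a b ≡ f (a ∸ i) (b ∸ j)
shift-yes i j f {a} {b} i≤a j≤b with i ≤? a | j ≤? b
... | yes _  | yes _  = refl
... | no i≰a | _      = ⊥-elim (i≰a i≤a)
... | yes _  | no j≰b = ⊥-elim (j≰b j≤b)

shift-missˡ : ∀ i j f {a} b → a < i → shift i j f a b ≡ 0ℤ
shift-missˡ i j f {a} b a<i with i ≤? a | j ≤? b
... | yes i≤a | _     = ⊥-elim (ℕₚ.<⇒≱ a<i i≤a)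
... | no _    | yes _ = refl
... | no _    | no _  = refl

shift-missʳ : ∀ i j f a {b} → b < j → shift i j f a b ≡ 0ℤ
shift-missʳ i j f a {b} b<j with i ≤? a | j ≤? b
... | _     | yes j≤b = ⊥-elim (ℕₚ.<⇒≱ b<j j≤b)
... | yes _ | no _    = refl
... | no _  | no _    = refl

shift-zero : ∀ f → shift 0 0 f ≈ f
shift-zero f .coeff a b = shift-yes 0 0 f z≤n z≤n

mono-⊗ : ∀ c i j f a b → (mono c i j ⊗ f) a b ≡ c ℤ.* shift i j f a b
mono-⊗ c i j f a b with i ≤? a | j ≤? b
... | yes i≤a | yes j≤b =
  trans (Σ≤-single a i _ i≤a λ i′ i′≢i → Σ≤-zero b λ j′ _ →
           *-vanishˡ _ (mono-miss c i j i′ j′ λ i′≡i _ → i′≢i i′≡i))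
        (trans (Σ≤-single b j _ j≤b λ j′ j′≢j → *-vanishˡ _ (mono-miss c i j i j′ λ _ j′≡j → j′≢j j′≡j))
               (cong (ℤ._* f (a ∸ i) (b ∸ j)) (mono-hit c i j)))
... | no i≰a | _ =
  trans (Σ≤-zero a λ i′ i′≤a → Σ≤-zero b λ j′ _ →
           *-vanishˡ (f (a ∸ i′) (b ∸ j′)) (mono-miss c i j i′ j′ λ { refl _ → i≰a i′≤a }))
        (sym (ℤₚ.*-zeroʳ c))
... | yes _ | no j≰b =
  trans (Σ≤-zero a λ i′ _ → Σ≤-zero b λ j′ j′≤b →
           *-vanishˡ (f (a ∸ i′) (b ∸ j′)) (mono-miss c i j i′ j′ λ { _ refl → j≰b j′≤b }))
        (sym (ℤₚ.*-zeroʳ c))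

x^q^-⊗ : ∀ i j f → (x^ i q^ j ⊗ f) ≈ shift i j f
x^q^-⊗ i j f .coeff a b = trans (mono-⊗ (+ 1) i j f a b) (ℤₚ.*-identityˡ _)

⊗-identityˡ : ∀ f → one ⊗ f ≈ f
⊗-identityˡ f = ≈-trans (x^q^-⊗ 0 0 f) (shift-zero f)

⊗-comm : ∀ f g → f ⊗ g ≈ g ⊗ f
⊗-comm f g .coeff a b = begin
  Σ≤ a (λ i → Σ≤ b (λ j → f i j ℤ.* g (a ∸ i) (b ∸ j)))
    ≡⟨ Σ≤-reverse a _ ⟩
  Σ≤ a (λ i → Σ≤ b (λ j → f (a ∸ i) j ℤ.* g (a ∸ (a ∸ i)) (b ∸ j)))
    ≡⟨ Σ≤-cong a (λ i → Σ≤-reverse b _) ⟩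
  Σ≤ a (λ i → Σ≤ b (λ j → f (a ∸ i) (b ∸ j) ℤ.* g (a ∸ (a ∸ i)) (b ∸ (b ∸ j))))
    ≡⟨ Σ≤-cong-≤ a (λ i i≤a → Σ≤-cong-≤ b λ j j≤b →
         trans (ℤₚ.*-comm (f (a ∸ i) (b ∸ j)) _)
               (cong₂ (λ u v → g u v ℤ.* f (a ∸ i) (b ∸ j)) (ℕₚ.m∸[m∸n]≡n i≤a) (ℕₚ.m∸[m∸n]≡n j≤b))) ⟩
  Σ≤ a (λ i → Σ≤ b (λ j → g i j ℤ.* f (a ∸ i) (b ∸ j)))
    ∎
  where open ≡-Reasoning

⊗-identityʳ : ∀ f → f ⊗ one ≈ f
⊗-identityʳ f = ≈-trans (⊗-comm f one) (⊗-identityˡ f)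

⊗-cong : ∀ {f f′ g g′} → f ≈ f′ → g ≈ g′ → f ⊗ g ≈ f′ ⊗ g′
⊗-cong f≈f′ g≈g′ .coeff a b =
  Σ≤-cong a λ i → Σ≤-cong b λ j → cong₂ ℤ._*_ (coeff f≈f′ i j) (coeff g≈g′ (a ∸ i) (b ∸ j))

⊗-congˡ : ∀ {f f′} g → f ≈ f′ → f ⊗ g ≈ f′ ⊗ g
⊗-congˡ g f≈f′ = ⊗-cong f≈f′ (≈-refl {g})

⊗-congʳ : ∀ f {g g′} → g ≈ g′ → f ⊗ g ≈ f ⊗ g′
⊗-congʳ f g≈g′ = ⊗-cong (≈-refl {f}) g≈g′

⊗-congʳ-≤ : ∀ f {g g′} a b → (∀ a′ b′ → a′ ≤ a → b′ ≤ b → g a′ b′ ≡ g′ a′ b′) →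
            (f ⊗ g) a b ≡ (f ⊗ g′) a b
⊗-congʳ-≤ f a b g≡g′ = Σ≤-cong a λ i → Σ≤-cong b λ j →
  cong (f i j ℤ.*_) (g≡g′ (a ∸ i) (b ∸ j) (ℕₚ.m∸n≤m a i) (ℕₚ.m∸n≤m b j))

⊕-cong : ∀ {f f′ g g′} → f ≈ f′ → g ≈ g′ → f ⊕ g ≈ f′ ⊕ g′
⊕-cong f≈f′ g≈g′ .coeff a b = cong₂ ℤ._+_ (coeff f≈f′ a b) (coeff g≈g′ a b)

⊕-congˡ : ∀ {f f′} g → f ≈ f′ → f ⊕ g ≈ f′ ⊕ g
⊕-congˡ g f≈f′ = ⊕-cong f≈f′ (≈-refl {g})

⊕-congʳ : ∀ f {g g′} → g ≈ g′ → f ⊕ g ≈ f ⊕ g′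
⊕-congʳ f g≈g′ = ⊕-cong (≈-refl {f}) g≈g′

≈⇒⊖≡0 : ∀ {f g} → f ≈ g → ∀ a b → (f ⊖ g) a b ≡ 0ℤ
≈⇒⊖≡0 {f} {g} f≈g a b = trans (cong (ℤ._- g a b) (coeff f≈g a b)) (ℤₚ.+-inverseʳ (g a b))

⊖-cong : ∀ {f f′ g g′} → f ≈ f′ → g ≈ g′ → f ⊖ g ≈ f′ ⊖ g′
⊖-cong f≈f′ g≈g′ .coeff a b = cong₂ ℤ._-_ (coeff f≈f′ a b) (coeff g≈g′ a b)

⊗-distribˡ-⊕ : ∀ f g h → f ⊗ (g ⊕ h) ≈ f ⊗ g ⊕ f ⊗ h
⊗-distribˡ-⊕ f g h .coeff a b =
  trans (Σ≤-cong a λ i → trans (Σ≤-cong b λ j → ℤₚ.*-distribˡ-+ (f i j) _ _) (Σ≤-distrib-+ b _ _))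
        (Σ≤-distrib-+ a _ _)

⊗-distribʳ-⊕ : ∀ f g h → (g ⊕ h) ⊗ f ≈ g ⊗ f ⊕ h ⊗ f
⊗-distribʳ-⊕ f g h .coeff a b =
  trans (Σ≤-cong a λ i → trans (Σ≤-cong b λ j → ℤₚ.*-distribʳ-+ (f (a ∸ i) (b ∸ j)) (g i j) (h i j))
                                (Σ≤-distrib-+ b _ _))
        (Σ≤-distrib-+ a _ _)

⊗-distribʳ-⊖ : ∀ f g h → (g ⊖ h) ⊗ f ≈ g ⊗ f ⊖ h ⊗ f
⊗-distribʳ-⊖ f g h .coeff a b =
  trans (Σ≤-cong a λ i → trans (Σ≤-cong b λ j → *-distribʳ-- (f (a ∸ i) (b ∸ j)) (g i j) (h i j))
                                (Σ≤-distrib-- b _ _))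
        (Σ≤-distrib-- a _ _)

⊗-assoc : ∀ f g h → (f ⊗ g) ⊗ h ≈ f ⊗ (g ⊗ h)
⊗-assoc f g h .coeff a b = trans (left≡canonical) (sym right≡canonical)
  where
  open ≡-Reasoning
  split : ∀ m {k} i → k ≤ i → m ∸ i ≡ m ∸ k ∸ (i ∸ k)
  split m {k} i k≤i = trans (cong (m ∸_) (sym (ℕₚ.m+[n∸m]≡n k≤i))) (sym (ℕₚ.∸-+-assoc m k (i ∸ k)))
  canonical : ℤ
  canonical = Σ≤ a λ i → Σ≤ (a ∸ i) λ d → Σ≤ b λ j → Σ≤ (b ∸ j) λ e →
                (f i j ℤ.* g d e) ℤ.* h (a ∸ i ∸ d) (b ∸ j ∸ e)
  inner : ℕ → ℕ → ℤ
  inner i d = Σ≤ b λ j′ → Σ≤ j′ λ j → (f i j ℤ.* g d (j′ ∸ j)) ℤ.* h (a ∸ i ∸ d) (b ∸ j′)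
  left≡canonical : ((f ⊗ g) ⊗ h) a b ≡ canonical
  left≡canonical = begin
    Σ≤ a (λ i′ → Σ≤ b λ j′ → Σ≤ i′ (λ i → Σ≤ j′ λ j → f i j ℤ.* g (i′ ∸ i) (j′ ∸ j)) ℤ.* h (a ∸ i′) (b ∸ j′))
      ≡⟨ Σ≤-cong a (λ i′ → Σ≤-cong b λ j′ → trans (*-distribʳ-Σ≤ i′ _ _) (Σ≤-cong i′ λ i → *-distribʳ-Σ≤ j′ _ _)) ⟩
    Σ≤ a (λ i′ → Σ≤ b λ j′ → Σ≤ i′ λ i → Σ≤ j′ λ j → (f i j ℤ.* g (i′ ∸ i) (j′ ∸ j)) ℤ.* h (a ∸ i′) (b ∸ j′))
      ≡⟨ Σ≤-cong a (λ i′ → Σ≤-comm b i′ _) ⟩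
    Σ≤ a (λ i′ → Σ≤ i′ λ i → Σ≤ b λ j′ → Σ≤ j′ λ j → (f i j ℤ.* g (i′ ∸ i) (j′ ∸ j)) ℤ.* h (a ∸ i′) (b ∸ j′))
      ≡⟨ Σ≤-cong a (λ i′ → Σ≤-cong-≤ i′ λ i i≤i′ → Σ≤-cong b λ j′ → Σ≤-cong j′ λ j →
           cong (λ m → (f i j ℤ.* g (i′ ∸ i) (j′ ∸ j)) ℤ.* h m (b ∸ j′)) (split a i′ i≤i′)) ⟩
    Σ≤ a (λ i′ → Σ≤ i′ λ i → inner i (i′ ∸ i))
      ≡⟨ Σ≤-triangle a inner ⟩
    Σ≤ a (λ i → Σ≤ (a ∸ i) (inner i))
      ≡⟨ Σ≤-cong a (λ i → Σ≤-cong (a ∸ i) λ d →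
           trans (Σ≤-cong b λ j′ → Σ≤-cong-≤ j′ λ j j≤j′ →
                    cong (λ m → (f i j ℤ.* g d (j′ ∸ j)) ℤ.* h (a ∸ i ∸ d) m) (split b j′ j≤j′))
                 (Σ≤-triangle b λ j e → (f i j ℤ.* g d e) ℤ.* h (a ∸ i ∸ d) (b ∸ j ∸ e))) ⟩
    canonical
      ∎
  right≡canonical : (f ⊗ (g ⊗ h)) a b ≡ canonical
  right≡canonical = begin
    Σ≤ a (λ i → Σ≤ b λ j → f i j ℤ.* Σ≤ (a ∸ i) λ d → Σ≤ (b ∸ j) λ e → g d e ℤ.* h (a ∸ i ∸ d) (b ∸ j ∸ e))
      ≡⟨ Σ≤-cong a (λ i → Σ≤-cong b λ j → trans (*-distribˡ-Σ≤ (a ∸ i) (f i j) _) (Σ≤-cong (a ∸ i) λ d →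
           trans (*-distribˡ-Σ≤ (b ∸ j) (f i j) _) (Σ≤-cong (b ∸ j) λ e → sym (ℤₚ.*-assoc (f i j) (g d e) _)))) ⟩
    Σ≤ a (λ i → Σ≤ b λ j → Σ≤ (a ∸ i) λ d → Σ≤ (b ∸ j) λ e → (f i j ℤ.* g d e) ℤ.* h (a ∸ i ∸ d) (b ∸ j ∸ e))
      ≡⟨ Σ≤-cong a (λ i → Σ≤-comm b (a ∸ i) _) ⟩
    canonical
      ∎

⊗-commutativeMonoid : CommutativeMonoid _ _
⊗-commutativeMonoid = record
  { Carrier = Series ; _≈_ = _≈_ ; _∙_ = _⊗_ ; ε = one
  ; isCommutativeMonoid = record
    { isMonoid = record
      { isSemigroup = record
        { isMagma = record { isEquivalence = Setoid.isEquivalence ≈-setoid ; ∙-cong = ⊗-cong }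
        ; assoc = ⊗-assoc }
      ; identity = ⊗-identityˡ , ⊗-identityʳ }
    ; comm = ⊗-comm } }

module ⊗-Solver = Algebra.Solver.CommutativeMonoid ⊗-commutativeMonoid using (solve; _⊜_) renaming (_⊕_ to _∙_)

mono-transport : ∀ c {i j a b i′ j′ a′ b′} → (a ≡ i → b ≡ j → a′ ≡ i′ × b′ ≡ j′) →
                 (a′ ≡ i′ → b′ ≡ j′ → a ≡ i × b ≡ j) → mono c i j a b ≡ mono c i′ j′ a′ b′
mono-transport c {i} {j} {a} {b} {i′} {j′} {a′} {b′} ⇒ ⇐ with a ℕ.≟ i | b ℕ.≟ j
... | yes a≡i | yes b≡j = sym (mono-hit′ (⇒ a≡i b≡j))
  where
  mono-hit′ : ∀ {a′ b′} → a′ ≡ i′ × b′ ≡ j′ → mono c i′ j′ a′ b′ ≡ c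
  mono-hit′ (refl , refl) = mono-hit c i′ j′
... | yes _ | no b≢j = sym (mono-miss c i′ j′ a′ b′ λ a′≡i′ b′≡j′ → b≢j (proj₂ (⇐ a′≡i′ b′≡j′)))
... | no a≢i | _     = sym (mono-miss c i′ j′ a′ b′ λ a′≡i′ b′≡j′ → a≢i (proj₁ (⇐ a′≡i′ b′≡j′)))

shift-mono : ∀ c i j i′ j′ → shift i j (mono c i′ j′) ≈ mono c (i + i′) (j + j′)
shift-mono c i j i′ j′ .coeff a b with i ≤? a | j ≤? b
... | yes i≤a | yes j≤b =
  mono-transport c (λ e₁ e₂ → peel i≤a e₁ , peel j≤b e₂) (λ e₁ e₂ → unpeel i e₁ , unpeel j e₂)
  where
  peel : ∀ {k m n} → k ≤ m → m ∸ k ≡ n → m ≡ k + n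
  peel k≤m refl = sym (ℕₚ.m+[n∸m]≡n k≤m)
  unpeel : ∀ k {m n} → m ≡ k + n → m ∸ k ≡ n
  unpeel k {n = n} refl = ℕₚ.m+n∸m≡n k n
... | no i≰a  | _       = sym (mono-miss c _ _ a b λ { refl _ → i≰a (ℕₚ.m≤m+n i i′) })
... | yes _   | no j≰b  = sym (mono-miss c _ _ a b λ { _ refl → j≰b (ℕₚ.m≤m+n j j′) })

x^q^-⊗-x^q^ : ∀ i j i′ j′ → x^ i q^ j ⊗ x^ i′ q^ j′ ≈ x^ (i + i′) q^ (j + j′)
x^q^-⊗-x^q^ i j i′ j′ = ≈-trans (x^q^-⊗ i j (x^ i′ q^ j′)) (shift-mono (+ 1) i j i′ j′)

x^q^-cong : ∀ {i i′ j j′} → i ≡ i′ → j ≡ j′ → x^ i q^ j ≈ x^ i′ q^ j′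
x^q^-cong refl refl = ≈-refl

⊕-assoc : ∀ f g h → (f ⊕ g) ⊕ h ≈ f ⊕ (g ⊕ h)
⊕-assoc f g h .coeff a b = ℤₚ.+-assoc (f a b) (g a b) (h a b)

⊕-comm : ∀ f g → f ⊕ g ≈ g ⊕ f
⊕-comm f g .coeff a b = ℤₚ.+-comm (f a b) (g a b)

⊕-cancelʳ : ∀ h {f g} → f ⊕ h ≈ g ⊕ h → f ≈ g
⊕-cancelʳ h {f} {g} f+h≈g+h .coeff a b = +-cancelʳ (h a b) (f a b) (g a b) (coeff f+h≈g+h a b)

x^q^-⊗-⊕ : ∀ i j f i′ j′ g →
           x^ i q^ j ⊗ (f ⊕ x^ i′ q^ j′ ⊗ g) ≈ x^ i q^ j ⊗ f ⊕ x^ (i + i′) q^ (j + j′) ⊗ g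
x^q^-⊗-⊕ i j f i′ j′ g = ≈-trans (⊗-distribˡ-⊕ (x^ i q^ j) f (x^ i′ q^ j′ ⊗ g))
  (⊕-congʳ (x^ i q^ j ⊗ f)
          (≈-trans (≈-sym (⊗-assoc (x^ i q^ j) (x^ i′ q^ j′) g)) (⊗-congˡ g (x^q^-⊗-x^q^ i j i′ j′))))

^ˢ-vanish : ∀ m → m 0 0 ≡ 0ℤ → ∀ k a b → a + b < k → (m ^ˢ k) a b ≡ 0ℤ
^ˢ-vanish m m₀₀≡0 zero    a b ()
^ˢ-vanish m m₀₀≡0 (suc k) a b a+b<1+k = Σ≤-zero a λ i i≤a → Σ≤-zero b λ j j≤b → vanishes i j i≤a j≤b
  where
  lower : ∀ {i j} → i ≤ a → j ≤ b → 0 < i + j → (a ∸ i) + (b ∸ j) < k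
  lower {i} {j} i≤a j≤b 0<i+j = ℕₚ.+-cancelʳ-< (i + j) _ k (begin-strict
    (a ∸ i) + (b ∸ j) + (i + j) ≡⟨ rearrange (a ∸ i) (b ∸ j) i j ⟩
    (a ∸ i + i) + (b ∸ j + j)   ≡⟨ cong₂ _+_ (ℕₚ.m∸n+n≡m i≤a) (ℕₚ.m∸n+n≡m j≤b) ⟩
    a + b                       <⟨ ℕₚ.≤-<-trans (ℕₚ.≤-pred a+b<1+k) (ℕₚ.m<m+n k 0<i+j) ⟩
    k + (i + j)                 ∎)
    where
    open ℕₚ.≤-Reasoning
    rearrange : ∀ x y z w → x + y + (z + w) ≡ (x + z) + (y + w)
    rearrange = ℕ-Solver.solve-∀
  vanishes : ∀ i j → i ≤ a → j ≤ b → m i j ℤ.* (m ^ˢ k) (a ∸ i) (b ∸ j) ≡ 0ℤ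
  vanishes zero    zero    _   _   = *-vanishˡ ((m ^ˢ k) a b) m₀₀≡0
  vanishes zero    (suc j) i≤a j≤b =
    *-vanishʳ (m 0 (suc j)) (^ˢ-vanish m m₀₀≡0 k a (b ∸ suc j) (lower i≤a j≤b (s≤s z≤n)))
  vanishes (suc i) j       i≤a j≤b =
    *-vanishʳ (m (suc i) j) (^ˢ-vanish m m₀₀≡0 k (a ∸ suc i) (b ∸ j) (lower i≤a j≤b (s≤s z≤n)))

-- With m = 1 - p, p ⊗ m^k = m^k - m^(k+1) telescopes, and m^k has no terms of total degree < k.
⊗-recipʳ : ∀ p → p 0 0 ≡ 1ℤ → p ⊗ recip p ≈ one
⊗-recipʳ p p₀₀≡1 .coeff a b = begin
  Σ≤ a (λ i → Σ≤ b λ j → p i j ℤ.* Σ≤ ((a ∸ i) + (b ∸ j)) λ k → (m ^ˢ k) (a ∸ i) (b ∸ j))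
    ≡⟨ Σ≤-cong-≤ a (λ i i≤a → Σ≤-cong-≤ b λ j j≤b → cong (p i j ℤ.*_) (sym (Σ≤-extend _
         (ℕₚ.+-mono-≤ (ℕₚ.m∸n≤m a i) (ℕₚ.m∸n≤m b j)) λ k lt _ → ^ˢ-vanish m m₀₀≡0 k _ _ lt))) ⟩
  Σ≤ a (λ i → Σ≤ b λ j → p i j ℤ.* Σ≤ (a + b) λ k → (m ^ˢ k) (a ∸ i) (b ∸ j))
    ≡⟨ Σ≤-cong a (λ i → Σ≤-cong b λ j → *-distribˡ-Σ≤ (a + b) (p i j) _) ⟩
  Σ≤ a (λ i → Σ≤ b λ j → Σ≤ (a + b) λ k → p i j ℤ.* (m ^ˢ k) (a ∸ i) (b ∸ j))
    ≡⟨ trans (Σ≤-cong a λ i → Σ≤-comm b (a + b) _) (Σ≤-comm a (a + b) _) ⟩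
  Σ≤ (a + b) (λ k → (p ⊗ (m ^ˢ k)) a b)
    ≡⟨ Σ≤-cong (a + b) (λ k → coeff (p⊗m^k k) a b) ⟩
  Σ≤ (a + b) (λ k → (m ^ˢ k) a b ℤ.- (m ^ˢ suc k) a b)
    ≡⟨ Σ≤-telescope (a + b) (λ k → (m ^ˢ k) a b) ⟩
  one a b ℤ.- (m ^ˢ suc (a + b)) a b
    ≡⟨ cong (λ v → one a b ℤ.- v) (^ˢ-vanish m m₀₀≡0 (suc (a + b)) a b ℕₚ.≤-refl) ⟩
  one a b ℤ.- 0ℤ
    ≡⟨ ℤₚ.+-identityʳ _ ⟩
  one a b
    ∎
  where
  open ≡-Reasoning
  m : Series
  m = one ⊖ p
  m₀₀≡0 : m 0 0 ≡ 0ℤ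
  m₀₀≡0 = cong (λ v → 1ℤ ℤ.- v) p₀₀≡1
  p≈1-m : p ≈ one ⊖ m
  p≈1-m .coeff x y = sym (cancel (one x y) (p x y))
    where
    cancel : ∀ u v → u ℤ.- (u ℤ.- v) ≡ v
    cancel = solve-∀
  p⊗m^k : ∀ k → p ⊗ (m ^ˢ k) ≈ (m ^ˢ k) ⊖ (m ^ˢ suc k)
  p⊗m^k k = ≈-trans (⊗-congˡ (m ^ˢ k) p≈1-m)
              (≈-trans (⊗-distribʳ-⊖ (m ^ˢ k) one m) (⊖-cong (⊗-identityˡ (m ^ˢ k)) ≈-refl))

recip-unique : ∀ p g → p 0 0 ≡ 1ℤ → p ⊗ g ≈ one → g ≈ recip p
recip-unique p g p₀₀≡1 p⊗g≈1 = begin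
  g                      ≈⟨ ≈-sym (⊗-identityʳ g) ⟩
  g ⊗ one                ≈⟨ ⊗-congʳ g (≈-sym (⊗-recipʳ p p₀₀≡1)) ⟩
  g ⊗ (p ⊗ recip p)      ≈⟨ ≈-sym (⊗-assoc g p (recip p)) ⟩
  (g ⊗ p) ⊗ recip p      ≈⟨ ⊗-congˡ (recip p) (≈-trans (⊗-comm g p) p⊗g≈1) ⟩
  one ⊗ recip p          ≈⟨ ⊗-identityˡ (recip p) ⟩
  recip p                ∎
  where open ≈-Reasoning

q2poch-constant : ∀ N → q2poch N 0 0 ≡ 1ℤ
q2poch-constant zero    = refl
q2poch-constant (suc N) = cong (ℤ._* (one ⊖ x^ 0 q^ (2 + 2 * N)) 0 0) (q2poch-constant N)

q2poch⁻¹ : ℕ → Series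
q2poch⁻¹ N = recip (q2poch N)

q2poch⁻¹-suc : ∀ N → q2poch⁻¹ (suc N) ⊗ (one ⊖ x^ 0 q^ (2 + 2 * N)) ≈ q2poch⁻¹ N
q2poch⁻¹-suc N = recip-unique (q2poch N) (r ⊗ u) (q2poch-constant N) (begin
  q2poch N ⊗ (r ⊗ u)    ≈⟨ ⊗-congʳ (q2poch N) (⊗-comm r u) ⟩
  q2poch N ⊗ (u ⊗ r)    ≈⟨ ≈-sym (⊗-assoc (q2poch N) u r) ⟩
  q2poch (suc N) ⊗ r    ≈⟨ ⊗-recipʳ (q2poch (suc N)) (q2poch-constant (suc N)) ⟩
  one                   ∎)
  where
  open ≈-Reasoning
  u = one ⊖ x^ 0 q^ (2 + 2 * N)
  r = q2poch⁻¹ (suc N)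

Π<-cong : ∀ K {f g : ℕ → Series} → (∀ i → f i ≈ g i) → Π< K f ≈ Π< K g
Π<-cong zero    f≈g = ≈-refl
Π<-cong (suc K) f≈g = ⊗-cong (Π<-cong K f≈g) (f≈g K)

Π<-suc : ∀ K (f : ℕ → Series) → Π< (suc K) f ≈ f 0 ⊗ Π< K (f ∘ suc)
Π<-suc zero    f = ≈-trans (⊗-identityˡ (f 0)) (≈-sym (⊗-identityʳ (f 0)))
Π<-suc (suc K) f = ≈-trans (⊗-congˡ (f (suc K)) (Π<-suc K f)) (⊗-assoc (f 0) (Π< K (f ∘ suc)) (f (suc K)))

negxFactor : ℕ → ℕ → Series
negxFactor c i = one ⊕ x^ 1 q^ (c + 2 * i)

⊗-one⊕x^q^-below : ∀ P d a {b} → b < d → (P ⊗ (one ⊕ x^ 1 q^ d)) a b ≡ P a b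
⊗-one⊕x^q^-below P d a {b} b<d = begin
  (P ⊗ (one ⊕ x^ 1 q^ d)) a b              ≡⟨ coeff (⊗-distribˡ-⊕ P one (x^ 1 q^ d)) a b ⟩
  (P ⊗ one) a b ℤ.+ (P ⊗ x^ 1 q^ d) a b    ≡⟨ cong₂ ℤ._+_ (coeff (⊗-identityʳ P) a b) x^q^-term≡0 ⟩
  P a b ℤ.+ 0ℤ                             ≡⟨ ℤₚ.+-identityʳ _ ⟩
  P a b                                    ∎
  where
  open ≡-Reasoning
  x^q^-term≡0 : (P ⊗ x^ 1 q^ d) a b ≡ 0ℤ
  x^q^-term≡0 = trans (coeff (⊗-comm P (x^ 1 q^ d)) a b) (trans (coeff (x^q^-⊗ 1 d P) a b) (shift-missʳ 1 d P a b<d))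

Π<-negxFactor-stable : ∀ c a {b} K → b < K → Π< K (negxFactor c) a b ≡ negxPochInf c a b
Π<-negxFactor-stable c a {b} K b<K =
  trans (cong (λ K′ → Π< K′ (negxFactor c) a b) (sym (ℕₚ.m∸n+n≡m b<K))) (stable (K ∸ suc b))
  where
  stable : ∀ k → Π< (k + suc b) (negxFactor c) a b ≡ negxPochInf c a b
  stable zero    = refl
  stable (suc k) = trans (⊗-one⊕x^q^-below (Π< (k + suc b) (negxFactor c)) (c + 2 * (k + suc b)) a b<exponent) (stable k)
    where
    b<exponent : b < c + 2 * (k + suc b)
    b<exponent = ℕₚ.≤-trans (ℕₚ.m≤n+m (suc b) k) (ℕₚ.≤-trans (ℕₚ.m≤n*m (k + suc b) 2) (ℕₚ.m≤n+m _ c))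

negxPochInf-unfold : ∀ c → negxPochInf c ≈ (one ⊕ x^ 1 q^ c) ⊗ negxPochInf (2 + c)
negxPochInf-unfold c .coeff a b = begin
  negxPochInf c a b
    ≡⟨ sym (Π<-negxFactor-stable c a (2 + b) (s≤s (ℕₚ.n≤1+n b))) ⟩
  Π< (2 + b) (negxFactor c) a b
    ≡⟨ coeff (Π<-suc (suc b) (negxFactor c)) a b ⟩
  (negxFactor c 0 ⊗ Π< (suc b) (negxFactor c ∘ suc)) a b
    ≡⟨ coeff (⊗-cong first-factor (Π<-cong (suc b) shifted-factor)) a b ⟩
  ((one ⊕ x^ 1 q^ c) ⊗ Π< (suc b) (negxFactor (2 + c))) a b
    ≡⟨ ⊗-congʳ-≤ (one ⊕ x^ 1 q^ c) a b
         (λ a′ b′ _ b′≤b → Π<-negxFactor-stable (2 + c) a′ (suc b) (s≤s b′≤b)) ⟩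
  ((one ⊕ x^ 1 q^ c) ⊗ negxPochInf (2 + c)) a b
    ∎
  where
  open ≡-Reasoning
  first-factor : negxFactor c 0 ≈ one ⊕ x^ 1 q^ c
  first-factor = ⊕-congʳ one (x^q^-cong {1} refl (ℕₚ.+-identityʳ c))
  shifted-factor : ∀ i → negxFactor c (suc i) ≈ negxFactor (2 + c) i
  shifted-factor i = ⊕-congʳ one (x^q^-cong {1} refl (reassociate c i))
    where
    reassociate : ∀ c i → c + 2 * suc i ≡ 2 + c + 2 * i
    reassociate = ℕ-Solver.solve-∀

-- σ f (x, q) = f (x q², q).
σ : Series → Series
σ f a b with 2 * a ≤? b
... | yes _ = f a (b ∸ 2 * a)
... | no _  = 0ℤ

σ-yes : ∀ f a {b} → 2 * a ≤ b → σ f a b ≡ f a (b ∸ 2 * a)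
σ-yes f a {b} 2a≤b with 2 * a ≤? b
... | yes _   = refl
... | no 2a≰b = ⊥-elim (2a≰b 2a≤b)

σ-no : ∀ f a {b} → b < 2 * a → σ f a b ≡ 0ℤ
σ-no f a {b} b<2a with 2 * a ≤? b
... | yes 2a≤b = ⊥-elim (ℕₚ.<⇒≱ b<2a 2a≤b)
... | no _     = refl

σ-+ : ∀ f a b → σ f a (2 * a + b) ≡ f a b
σ-+ f a b = trans (σ-yes f a (ℕₚ.m≤m+n (2 * a) b)) (cong (f a) (ℕₚ.m+n∸m≡n (2 * a) b))

σ-cong : ∀ {f g} → f ≈ g → σ f ≈ σ g
σ-cong f≈g .coeff a b with 2 * a ≤? b
... | yes _ = coeff f≈g a (b ∸ 2 * a)
... | no _  = refl

σ-⊕ : ∀ f g → σ (f ⊕ g) ≈ σ f ⊕ σ g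
σ-⊕ f g .coeff a b with 2 * a ≤? b
... | yes _ = refl
... | no _  = refl

σ-mono : ∀ c i j → σ (mono c i j) ≈ mono c i (2 * i + j)
σ-mono c i j .coeff a b with 2 * a ≤? b
... | yes 2a≤b = mono-transport c
  (λ { refl e → refl , trans (sym (ℕₚ.m+[n∸m]≡n 2a≤b)) (cong (λ n → 2 * a + n) e) })
  (λ { refl refl → refl , ℕₚ.m+n∸m≡n (2 * a) j })
... | no 2a≰b  = sym (mono-miss c i (2 * i + j) a b λ { refl refl → 2a≰b (ℕₚ.m≤m+n (2 * a) j) })

σ-one : σ one ≈ one
σ-one = σ-mono (+ 1) 0 0

2*-split : ∀ a {i} → i ≤ a → 2 * a ≡ 2 * i + 2 * (a ∸ i)
2*-split a {i} i≤a = trans (cong (2 *_) (sym (ℕₚ.m+[n∸m]≡n i≤a))) (ℕₚ.*-distribˡ-+ 2 i (a ∸ i))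

σ-⊗-+ : ∀ f g a b → (σ f ⊗ σ g) a (2 * a + b) ≡ (f ⊗ g) a b
σ-⊗-+ f g a b = Σ≤-cong-≤ a λ i i≤a → let A = a ∸ i in begin
  Σ≤ (2 * a + b) (λ j → σ f i j ℤ.* σ g A (2 * a + b ∸ j))
    ≡⟨ cong (λ n → Σ≤ n λ j → σ f i j ℤ.* σ g A (2 * a + b ∸ j)) (split i≤a) ⟩
  Σ≤ (2 * i + (2 * A + b)) (λ j → σ f i j ℤ.* σ g A (2 * a + b ∸ j))
    ≡⟨ Σ≤-shift (2 * i) (2 * A + b) _ (λ j j<2i → *-vanishˡ _ (σ-no f i j<2i)) ⟩
  Σ≤ (2 * A + b) (λ j → σ f i (2 * i + j) ℤ.* σ g A (2 * a + b ∸ (2 * i + j)))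
    ≡⟨ Σ≤-cong (2 * A + b) (λ j → cong₂ ℤ._*_ (σ-+ f i j) (cong (σ g A) (cancel i≤a j))) ⟩
  Σ≤ (2 * A + b) (λ j → f i j ℤ.* σ g A (2 * A + b ∸ j))
    ≡⟨ Σ≤-extend _ (ℕₚ.m≤n+m b (2 * A)) (λ j b<j j≤ → *-vanishʳ (f i j) (σ-no g A (below b<j j≤))) ⟩
  Σ≤ b (λ j → f i j ℤ.* σ g A (2 * A + b ∸ j))
    ≡⟨ Σ≤-cong-≤ b (λ j j≤b → cong (f i j ℤ.*_)
         (trans (cong (σ g A) (ℕₚ.+-∸-assoc (2 * A) j≤b)) (σ-+ g A (b ∸ j)))) ⟩
  Σ≤ b (λ j → f i j ℤ.* g A (b ∸ j))
    ∎
  where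
  open ≡-Reasoning
  split : ∀ {i} → i ≤ a → 2 * a + b ≡ 2 * i + (2 * (a ∸ i) + b)
  split {i} i≤a = trans (cong (_+ b) (2*-split a i≤a)) (ℕₚ.+-assoc (2 * i) _ b)
  cancel : ∀ {i} → i ≤ a → ∀ j → 2 * a + b ∸ (2 * i + j) ≡ 2 * (a ∸ i) + b ∸ j
  cancel {i} i≤a j = trans (cong (_∸ (2 * i + j)) (split i≤a)) (ℕₚ.[m+n]∸[m+o]≡n∸o (2 * i) _ j)
  below : ∀ {x j} → b < j → j ≤ x + b → x + b ∸ j < x
  below {x} {j} b<j j≤x+b = subst (x + b ∸ j <_) (ℕₚ.m+n∸n≡m x b) (ℕₚ.∸-monoʳ-< b<j j≤x+b)

σ-⊗-low : ∀ f g a {b} → b < 2 * a → (σ f ⊗ σ g) a b ≡ 0ℤ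
σ-⊗-low f g a {b} b<2a = Σ≤-zero a λ i i≤a → Σ≤-zero b λ j j≤b → summand i≤a j≤b (2 * i ≤? j)
  where
  summand : ∀ {i j} → i ≤ a → j ≤ b → Dec (2 * i ≤ j) → σ f i j ℤ.* σ g (a ∸ i) (b ∸ j) ≡ 0ℤ
  summand {i} {j} _   _   (no 2i≰j)  = *-vanishˡ _ (σ-no f i (ℕₚ.≰⇒> 2i≰j))
  summand {i} {j} i≤a j≤b (yes 2i≤j) = *-vanishʳ (σ f i j) (σ-no g (a ∸ i) (begin
    suc (b ∸ j)               ≡⟨ ℕₚ.+-∸-assoc 1 j≤b ⟨
    suc b ∸ j                 ≤⟨ ℕₚ.∸-monoˡ-≤ j b<2a ⟩
    2 * a ∸ j                 ≤⟨ ℕₚ.∸-monoʳ-≤ (2 * a) 2i≤j ⟩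
    2 * a ∸ 2 * i             ≡⟨ cong (_∸ 2 * i) (2*-split a i≤a) ⟩
    2 * i + 2 * (a ∸ i) ∸ 2 * i ≡⟨ ℕₚ.m+n∸m≡n (2 * i) _ ⟩
    2 * (a ∸ i)               ∎))
    where open ℕₚ.≤-Reasoning

σ-⊗ : ∀ f g → σ (f ⊗ g) ≈ σ f ⊗ σ g
σ-⊗ f g .coeff a b with 2 * a ≤? b
... | yes 2a≤b = sym (trans (cong ((σ f ⊗ σ g) a) (sym (ℕₚ.m+[n∸m]≡n 2a≤b))) (σ-⊗-+ f g a (b ∸ 2 * a)))
... | no 2a≰b  = sym (σ-⊗-low f g a (ℕₚ.≰⇒> 2a≰b))

σ-Π< : ∀ K f → σ (Π< K f) ≈ Π< K (σ ∘ f)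
σ-Π< zero    f = σ-one
σ-Π< (suc K) f = ≈-trans (σ-⊗ (Π< K f) (f K)) (⊗-congˡ (σ (f K)) (σ-Π< K f))

σ-negxPochInf : ∀ c → σ (negxPochInf c) ≈ negxPochInf (2 + c)
σ-negxPochInf c .coeff a b = begin
  σ (negxPochInf c) a b                   ≡⟨ truncate (2 * a ≤? b) ⟩
  σ (Π< (suc b) (negxFactor c)) a b       ≡⟨ coeff (σ-Π< (suc b) (negxFactor c)) a b ⟩
  Π< (suc b) (σ ∘ negxFactor c) a b       ≡⟨ coeff (Π<-cong (suc b) σ-negxFactor) a b ⟩
  Π< (suc b) (negxFactor (2 + c)) a b     ≡⟨ Π<-negxFactor-stable (2 + c) a (suc b) ℕₚ.≤-refl ⟩
  negxPochInf (2 + c) a b                 ∎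
  where
  open ≡-Reasoning
  truncate : Dec (2 * a ≤ b) → σ (negxPochInf c) a b ≡ σ (Π< (suc b) (negxFactor c)) a b
  truncate (yes 2a≤b) = trans (σ-yes _ a 2a≤b)
    (trans (sym (Π<-negxFactor-stable c a (suc b) (s≤s (ℕₚ.m∸n≤m b (2 * a))))) (sym (σ-yes _ a 2a≤b)))
  truncate (no 2a≰b)  = trans (σ-no _ a (ℕₚ.≰⇒> 2a≰b)) (sym (σ-no _ a (ℕₚ.≰⇒> 2a≰b)))
  σ-negxFactor : ∀ i → σ (negxFactor c i) ≈ negxFactor (2 + c) i
  σ-negxFactor i = ≈-trans (σ-⊕ one (x^ 1 q^ (c + 2 * i)))
    (⊕-cong σ-one (≈-trans (σ-mono (+ 1) 1 (c + 2 * i)) (x^q^-cong {1} refl (reassociate c i))))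
    where
    reassociate : ∀ c i → 2 * 1 + (c + 2 * i) ≡ 2 + c + 2 * i
    reassociate = ℕ-Solver.solve-∀

XFree : Series → Set
XFree f = ∀ a b → f (suc a) b ≡ 0ℤ

XFree-one : XFree one
XFree-one a b = mono-miss (+ 1) 0 0 (suc a) b λ ()

XFree-q^ : ∀ j → XFree (x^ 0 q^ j)
XFree-q^ j a b = mono-miss (+ 1) 0 j (suc a) b λ ()

XFree-⊖ : ∀ f g → XFree f → XFree g → XFree (f ⊖ g)
XFree-⊖ f g f₀ g₀ a b = cong₂ ℤ._-_ (f₀ a b) (g₀ a b)

XFree-⊗ : ∀ f g → XFree f → XFree g → XFree (f ⊗ g)
XFree-⊗ f g f₀ g₀ a b = Σ≤-zero (suc a) λ i _ → Σ≤-zero b λ j _ → summand i j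
  where
  summand : ∀ i j → f i j ℤ.* g (suc a ∸ i) (b ∸ j) ≡ 0ℤ
  summand zero    j = *-vanishʳ (f 0 j) (g₀ a (b ∸ j))
  summand (suc i) j = *-vanishˡ _ (f₀ i j)

XFree-^ˢ : ∀ m → XFree m → ∀ k → XFree (m ^ˢ k)
XFree-^ˢ m m₀ zero    = XFree-one
XFree-^ˢ m m₀ (suc k) = XFree-⊗ m (m ^ˢ k) m₀ (XFree-^ˢ m m₀ k)

XFree-recip : ∀ p → XFree p → XFree (recip p)
XFree-recip p p₀ a b = Σ≤-zero (suc a + b) λ k _ → XFree-^ˢ (one ⊖ p) (XFree-⊖ one p XFree-one p₀) k a b

XFree-q2poch⁻¹ : ∀ N → XFree (q2poch⁻¹ N)
XFree-q2poch⁻¹ N = XFree-recip (q2poch N) (q2poch-XFree N)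
  where
  q2poch-XFree : ∀ N → XFree (q2poch N)
  q2poch-XFree zero    = XFree-one
  q2poch-XFree (suc N) =
    XFree-⊗ (q2poch N) (one ⊖ u) (q2poch-XFree N) (XFree-⊖ one u XFree-one (XFree-q^ (2 + 2 * N)))
    where u = x^ 0 q^ (2 + 2 * N)

σ-XFree : ∀ f → XFree f → σ f ≈ f
σ-XFree f f₀ .coeff zero    b = σ-yes f 0 z≤n
σ-XFree f f₀ .coeff (suc a) b with 2 * suc a ≤? b
... | yes _ = trans (f₀ a _) (sym (f₀ a b))
... | no _  = sym (f₀ a b)

Σ≤ˢ : ℕ → (ℕ → Series) → Series
Σ≤ˢ K F a b = Σ≤ K λ N → F N a b

Σ△ˢ : ℕ → (ℕ → ℕ → Series) → Series
Σ△ˢ K F a b = Σ△ K λ N₁ N₂ → F N₁ N₂ a b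

⊗-Σ≤ˢ : ∀ f K F → f ⊗ Σ≤ˢ K F ≈ Σ≤ˢ K (λ N → f ⊗ F N)
⊗-Σ≤ˢ f K F .coeff a b = begin
  Σ≤ a (λ i → Σ≤ b λ j → f i j ℤ.* Σ≤ K λ N → F N (a ∸ i) (b ∸ j))
    ≡⟨ Σ≤-cong a (λ i → Σ≤-cong b λ j → *-distribˡ-Σ≤ K (f i j) _) ⟩
  Σ≤ a (λ i → Σ≤ b λ j → Σ≤ K λ N → f i j ℤ.* F N (a ∸ i) (b ∸ j))
    ≡⟨ trans (Σ≤-cong a λ i → Σ≤-comm b K _) (Σ≤-comm a K _) ⟩
  Σ≤ K (λ N → (f ⊗ F N) a b)
    ∎
  where open ≡-Reasoning

⊗-Σ△ˢ : ∀ f K F → f ⊗ Σ△ˢ K F ≈ Σ△ˢ K (λ N₁ N₂ → f ⊗ F N₁ N₂)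
⊗-Σ△ˢ f K F = ≈-trans (⊗-Σ≤ˢ f K λ N₁ → Σ≤ˢ N₁ (F N₁)) (record { coeff = λ a b →
  Σ≤-cong K λ N₁ → coeff (⊗-Σ≤ˢ f N₁ (F N₁)) a b })

-- The series R a b c

infix 4 x^_∣_
x^_∣_ : ℕ → Series → Set
x^ i ∣ f = ∀ a b → a < i → f a b ≡ 0ℤ

x^∣x^q^ : ∀ i j → x^ i ∣ x^ i q^ j
x^∣x^q^ i j a b a<i = mono-miss (+ 1) i j a b λ { refl _ → ℕₚ.<-irrefl refl a<i }

x^∣-⊗ : ∀ i f g → x^ i ∣ f → x^ i ∣ f ⊗ g
x^∣-⊗ i f g x^i∣f a b a<i = Σ≤-zero a λ a′ a′≤a → Σ≤-zero b λ b′ _ →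
  *-vanishˡ (g (a ∸ a′) (b ∸ b′)) (x^i∣f a′ b′ (ℕₚ.≤-<-trans a′≤a a<i))

qExp : ℕ → ℕ → ℕ → ℕ → ℕ
qExp a b N₁ N₂ = 2 * (N₁ * N₁ + N₂ * N₂) + a * N₁ + b * N₂

-- Opaque, so that the arguments of shape-cong are inferred from its type.
opaque
  shape : ℕ → ℕ → ℕ → ℕ → ℕ → Series
  shape i e d k₁ k₂ = x^ i q^ e ⊗ negxPochInf d ⊗ q2poch⁻¹ k₁ ⊗ q2poch⁻¹ k₂

opaque
  unfolding shape
  shape-unfold : ∀ i e d k₁ k₂ → shape i e d k₁ k₂ ≈ x^ i q^ e ⊗ negxPochInf d ⊗ q2poch⁻¹ k₁ ⊗ q2poch⁻¹ k₂
  shape-unfold i e d k₁ k₂ = ≈-refl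

shape-cong : ∀ {i i′ e e′ d d′ k₁ k₁′ k₂ k₂′} → i ≡ i′ → e ≡ e′ → d ≡ d′ → k₁ ≡ k₁′ → k₂ ≡ k₂′ →
             shape i e d k₁ k₂ ≈ shape i′ e′ d′ k₁′ k₂′
shape-cong refl refl refl refl refl = ≈-refl

summand : ℕ → ℕ → ℕ → ℕ → ℕ → Series
summand a b c N₁ N₂ = shape (N₁ + N₂) (qExp a b N₁ N₂) (1 + c + 2 * N₂) (N₁ ∸ N₂) N₂

term≈summand : ∀ N₁ N₂ → term N₁ N₂ ≈ summand 0 0 0 N₁ N₂
term≈summand N₁ N₂ =
  ≈-trans (≈-sym (shape-unfold (N₁ + N₂) (2 * (N₁ * N₁ + N₂ * N₂)) (1 + 2 * N₂) (N₁ ∸ N₂) N₂))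
          (shape-cong refl (sym (trans (ℕₚ.+-identityʳ _) (ℕₚ.+-identityʳ _))) refl refl refl)

x^∣summand : ∀ a b c N₁ N₂ → x^ (N₁ + N₂) ∣ summand a b c N₁ N₂
x^∣summand a b c N₁ N₂ a′ b′ a′<N₁+N₂ =
  trans (coeff (shape-unfold i e d (N₁ ∸ N₂) N₂) a′ b′)
        (x^∣-⊗ i (M ⊗ Q ⊗ q2poch⁻¹ (N₁ ∸ N₂)) (q2poch⁻¹ N₂)
          (x^∣-⊗ i (M ⊗ Q) (q2poch⁻¹ (N₁ ∸ N₂)) (x^∣-⊗ i M Q (x^∣x^q^ i e))) a′ b′ a′<N₁+N₂)
  where
  i = N₁ + N₂
  e = qExp a b N₁ N₂
  d = 1 + c + 2 * N₂
  M = x^ i q^ e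
  Q = negxPochInf d

σ-summand : ∀ a b c N₁ N₂ → σ (summand a b c N₁ N₂) ≈ summand (2 + a) (2 + b) (2 + c) N₁ N₂
σ-summand a b c N₁ N₂ = begin
  σ (summand a b c N₁ N₂)
    ≈⟨ σ-cong (shape-unfold (N₁ + N₂) e d k₁ N₂) ⟩
  σ (x^ (N₁ + N₂) q^ e ⊗ negxPochInf d ⊗ q2poch⁻¹ k₁ ⊗ q2poch⁻¹ N₂)
    ≈⟨ σ-⊗ _ _ ⟩
  σ (x^ (N₁ + N₂) q^ e ⊗ negxPochInf d ⊗ q2poch⁻¹ k₁) ⊗ σ (q2poch⁻¹ N₂)
    ≈⟨ ⊗-cong (σ-⊗ _ _) (σ-XFree _ (XFree-q2poch⁻¹ N₂)) ⟩
  σ (x^ (N₁ + N₂) q^ e ⊗ negxPochInf d) ⊗ σ (q2poch⁻¹ k₁) ⊗ q2poch⁻¹ N₂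
    ≈⟨ ⊗-congˡ (q2poch⁻¹ N₂) (⊗-cong (σ-⊗ _ _) (σ-XFree _ (XFree-q2poch⁻¹ k₁))) ⟩
  σ (x^ (N₁ + N₂) q^ e) ⊗ σ (negxPochInf d) ⊗ q2poch⁻¹ k₁ ⊗ q2poch⁻¹ N₂
    ≈⟨ ⊗-congˡ (q2poch⁻¹ N₂) (⊗-congˡ (q2poch⁻¹ k₁) (⊗-cong (σ-mono (+ 1) (N₁ + N₂) e) (σ-negxPochInf d))) ⟩
  x^ (N₁ + N₂) q^ (2 * (N₁ + N₂) + e) ⊗ negxPochInf (2 + d) ⊗ q2poch⁻¹ k₁ ⊗ q2poch⁻¹ N₂
    ≈⟨ shape-unfold _ _ _ _ _ ⟨
  shape (N₁ + N₂) (2 * (N₁ + N₂) + e) (2 + d) k₁ N₂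
    ≈⟨ shape-cong refl (exponent a b N₁ N₂) (offset c N₂) refl refl ⟩
  summand (2 + a) (2 + b) (2 + c) N₁ N₂
    ∎
  where
  open ≈-Reasoning
  e = qExp a b N₁ N₂
  d = 1 + c + 2 * N₂
  k₁ = N₁ ∸ N₂
  exponent : ∀ a b N₁ N₂ → 2 * (N₁ + N₂) + (2 * (N₁ * N₁ + N₂ * N₂) + a * N₁ + b * N₂)
                         ≡ 2 * (N₁ * N₁ + N₂ * N₂) + (2 + a) * N₁ + (2 + b) * N₂
  exponent = ℕ-Solver.solve-∀
  offset : ∀ c N₂ → 2 + (1 + c + 2 * N₂) ≡ 1 + (2 + c) + 2 * N₂
  offset = ℕ-Solver.solve-∀

x^q^-⊗-shape : ∀ i j I e d k₁ k₂ → x^ i q^ j ⊗ shape I e d k₁ k₂ ≈ shape (i + I) (j + e) d k₁ k₂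
x^q^-⊗-shape i j I e d k₁ k₂ = begin
  m ⊗ shape I e d k₁ k₂                  ≈⟨ ⊗-congʳ m (shape-unfold I e d k₁ k₂) ⟩
  m ⊗ (x^ I q^ e ⊗ Q ⊗ R₁ ⊗ R₂)          ≈⟨ reassociate m (x^ I q^ e) Q R₁ R₂ ⟩
  (m ⊗ x^ I q^ e) ⊗ Q ⊗ R₁ ⊗ R₂          ≈⟨ ⊗-congˡ R₂ (⊗-congˡ R₁ (⊗-congˡ Q (x^q^-⊗-x^q^ i j I e))) ⟩
  x^ (i + I) q^ (j + e) ⊗ Q ⊗ R₁ ⊗ R₂    ≈⟨ shape-unfold (i + I) (j + e) d k₁ k₂ ⟨
  shape (i + I) (j + e) d k₁ k₂          ∎
  where
  open ≈-Reasoning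
  open ⊗-Solver
  m = x^ i q^ j
  Q = negxPochInf d
  R₁ = q2poch⁻¹ k₁
  R₂ = q2poch⁻¹ k₂
  reassociate = solve 5 (λ m M Q R₁ R₂ → m ∙ (((M ∙ Q) ∙ R₁) ∙ R₂) ⊜ (((m ∙ M) ∙ Q) ∙ R₁) ∙ R₂) ≈-refl

shape-negxPochInf-unfold : ∀ i e d k₁ k₂ →
                           shape i e d k₁ k₂ ≈ shape i e (2 + d) k₁ k₂ ⊕ shape (1 + i) (d + e) (2 + d) k₁ k₂
shape-negxPochInf-unfold i e d k₁ k₂ = begin
  shape i e d k₁ k₂                          ≈⟨ shape-unfold i e d k₁ k₂ ⟩
  M ⊗ negxPochInf d ⊗ R₁ ⊗ R₂                ≈⟨ ⊗-congˡ R₂ (⊗-congˡ R₁ (⊗-congʳ M (negxPochInf-unfold d))) ⟩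
  M ⊗ ((one ⊕ m) ⊗ Q) ⊗ R₁ ⊗ R₂              ≈⟨ reassociate M (one ⊕ m) Q R₁ R₂ ⟩
  (one ⊕ m) ⊗ (M ⊗ Q ⊗ R₁ ⊗ R₂)              ≈⟨ ⊗-congʳ (one ⊕ m) (shape-unfold i e (2 + d) k₁ k₂) ⟨
  (one ⊕ m) ⊗ Y                              ≈⟨ ⊗-distribʳ-⊕ Y one m ⟩
  one ⊗ Y ⊕ m ⊗ Y                            ≈⟨ ⊕-cong (⊗-identityˡ Y) (x^q^-⊗-shape 1 d i e (2 + d) k₁ k₂) ⟩
  Y ⊕ shape (1 + i) (d + e) (2 + d) k₁ k₂    ∎
  where
  open ≈-Reasoning
  open ⊗-Solver
  M = x^ i q^ e
  m = x^ 1 q^ d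
  Q = negxPochInf (2 + d)
  R₁ = q2poch⁻¹ k₁
  R₂ = q2poch⁻¹ k₂
  Y = shape i e (2 + d) k₁ k₂
  reassociate = solve 5 (λ M P Q R₁ R₂ → ((M ∙ (P ∙ Q)) ∙ R₁) ∙ R₂ ⊜ P ∙ (((M ∙ Q) ∙ R₁) ∙ R₂)) ≈-refl

⊖-x^q^-⊗ : ∀ i j f → f ⊖ x^ i q^ j ⊗ f ≈ (one ⊖ x^ i q^ j) ⊗ f
⊖-x^q^-⊗ i j f = ≈-sym (≈-trans (⊗-distribʳ-⊖ f one (x^ i q^ j)) (⊖-cong (⊗-identityˡ f) ≈-refl))

shape-q2poch-step₁ : ∀ i e d k₁ k₂ →
                     shape i e d (suc k₁) k₂ ⊖ shape i (2 + 2 * k₁ + e) d (suc k₁) k₂ ≈ shape i e d k₁ k₂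
shape-q2poch-step₁ i e d k₁ k₂ = begin
  shape i e d (suc k₁) k₂ ⊖ shape i (2 + 2 * k₁ + e) d (suc k₁) k₂
    ≈⟨ ⊖-cong (≈-refl {shape i e d (suc k₁) k₂}) (x^q^-⊗-shape 0 (2 + 2 * k₁) i e d (suc k₁) k₂) ⟨
  shape i e d (suc k₁) k₂ ⊖ u ⊗ shape i e d (suc k₁) k₂
    ≈⟨ ⊖-x^q^-⊗ 0 (2 + 2 * k₁) (shape i e d (suc k₁) k₂) ⟩
  (one ⊖ u) ⊗ shape i e d (suc k₁) k₂
    ≈⟨ ⊗-congʳ (one ⊖ u) (shape-unfold i e d (suc k₁) k₂) ⟩
  (one ⊖ u) ⊗ (M ⊗ Q ⊗ q2poch⁻¹ (suc k₁) ⊗ R₂)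
    ≈⟨ reassociate (one ⊖ u) M Q (q2poch⁻¹ (suc k₁)) R₂ ⟩
  M ⊗ Q ⊗ (q2poch⁻¹ (suc k₁) ⊗ (one ⊖ u)) ⊗ R₂
    ≈⟨ ⊗-congˡ R₂ (⊗-congʳ (M ⊗ Q) (q2poch⁻¹-suc k₁)) ⟩
  M ⊗ Q ⊗ q2poch⁻¹ k₁ ⊗ R₂
    ≈⟨ shape-unfold i e d k₁ k₂ ⟨
  shape i e d k₁ k₂
    ∎
  where
  open ≈-Reasoning
  open ⊗-Solver
  u = x^ 0 q^ (2 + 2 * k₁)
  M = x^ i q^ e
  Q = negxPochInf d
  R₂ = q2poch⁻¹ k₂
  reassociate = solve 5 (λ v M Q R₁ R₂ → v ∙ (((M ∙ Q) ∙ R₁) ∙ R₂) ⊜ ((M ∙ Q) ∙ (R₁ ∙ v)) ∙ R₂) ≈-refl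

shape-q2poch-step₂ : ∀ i e d k₁ k₂ →
                     shape i e d k₁ (suc k₂) ⊖ shape i (2 + 2 * k₂ + e) d k₁ (suc k₂) ≈ shape i e d k₁ k₂
shape-q2poch-step₂ i e d k₁ k₂ = begin
  shape i e d k₁ (suc k₂) ⊖ shape i (2 + 2 * k₂ + e) d k₁ (suc k₂)
    ≈⟨ ⊖-cong (≈-refl {shape i e d k₁ (suc k₂)}) (x^q^-⊗-shape 0 (2 + 2 * k₂) i e d k₁ (suc k₂)) ⟨
  shape i e d k₁ (suc k₂) ⊖ u ⊗ shape i e d k₁ (suc k₂)
    ≈⟨ ⊖-x^q^-⊗ 0 (2 + 2 * k₂) (shape i e d k₁ (suc k₂)) ⟩
  (one ⊖ u) ⊗ shape i e d k₁ (suc k₂)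
    ≈⟨ ⊗-congʳ (one ⊖ u) (shape-unfold i e d k₁ (suc k₂)) ⟩
  (one ⊖ u) ⊗ (M ⊗ Q ⊗ R₁ ⊗ q2poch⁻¹ (suc k₂))
    ≈⟨ reassociate (one ⊖ u) M Q R₁ (q2poch⁻¹ (suc k₂)) ⟩
  M ⊗ Q ⊗ R₁ ⊗ (q2poch⁻¹ (suc k₂) ⊗ (one ⊖ u))
    ≈⟨ ⊗-congʳ (M ⊗ Q ⊗ R₁) (q2poch⁻¹-suc k₂) ⟩
  M ⊗ Q ⊗ R₁ ⊗ q2poch⁻¹ k₂
    ≈⟨ shape-unfold i e d k₁ k₂ ⟨
  shape i e d k₁ k₂
    ∎
  where
  open ≈-Reasoning
  open ⊗-Solver
  u = x^ 0 q^ (2 + 2 * k₂)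
  M = x^ i q^ e
  Q = negxPochInf d
  R₁ = q2poch⁻¹ k₁
  reassociate = solve 5 (λ v M Q R₁ R₂ → v ∙ (((M ∙ Q) ∙ R₁) ∙ R₂) ⊜ ((M ∙ Q) ∙ R₁) ∙ (R₂ ∙ v)) ≈-refl

summand-α : ∀ a b c N₁ N₂ →
            summand a b c N₁ N₂ ≈ summand a b (2 + c) N₁ N₂ ⊕ x^ 1 q^ (1 + c) ⊗ summand a (2 + b) (2 + c) N₁ N₂
summand-α a b c N₁ N₂ = begin
  summand a b c N₁ N₂
    ≈⟨ shape-negxPochInf-unfold i (qExp a b N₁ N₂) d (N₁ ∸ N₂) N₂ ⟩
  shape i (qExp a b N₁ N₂) (2 + d) (N₁ ∸ N₂) N₂ ⊕ shape (1 + i) (d + qExp a b N₁ N₂) (2 + d) (N₁ ∸ N₂) N₂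
    ≈⟨ ⊕-cong (shape-cong refl refl (sym (d-shift c N₂)) refl refl)
              (shape-cong refl (exponent a b c N₁ N₂) (sym (d-shift c N₂)) refl refl) ⟩
  summand a b (2 + c) N₁ N₂ ⊕ shape (1 + i) (1 + c + qExp a (2 + b) N₁ N₂) (1 + (2 + c) + 2 * N₂) (N₁ ∸ N₂) N₂
    ≈⟨ ⊕-congʳ (summand a b (2 + c) N₁ N₂) (x^q^-⊗-shape 1 (1 + c) i _ _ (N₁ ∸ N₂) N₂) ⟨
  summand a b (2 + c) N₁ N₂ ⊕ x^ 1 q^ (1 + c) ⊗ summand a (2 + b) (2 + c) N₁ N₂
    ∎
  where
  open ≈-Reasoning
  i = N₁ + N₂
  d = 1 + c + 2 * N₂
  d-shift : ∀ c N₂ → 1 + (2 + c) + 2 * N₂ ≡ 2 + (1 + c + 2 * N₂)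
  d-shift = ℕ-Solver.solve-∀
  exponent : ∀ a b c N₁ N₂ → 1 + c + 2 * N₂ + (2 * (N₁ * N₁ + N₂ * N₂) + a * N₁ + b * N₂)
                           ≡ 1 + c + (2 * (N₁ * N₁ + N₂ * N₂) + a * N₁ + (2 + b) * N₂)
  exponent = ℕ-Solver.solve-∀

summand-β : ∀ a b c M₁ M₂ → summand a b c (suc M₁) (suc M₂) ⊖ summand a (2 + b) c (suc M₁) (suc M₂)
                            ≈ x^ 2 q^ (4 + a + b) ⊗ summand (4 + a) (4 + b) (2 + c) M₁ M₂
summand-β a b c M₁ M₂ = begin
  shape i e d (M₁ ∸ M₂) (suc M₂) ⊖ shape i (qExp a (2 + b) (suc M₁) (suc M₂)) d (M₁ ∸ M₂) (suc M₂)
    ≈⟨ ⊖-cong (≈-refl {shape i e d (M₁ ∸ M₂) (suc M₂)}) (shape-cong refl (sym (raise a b M₁ M₂)) refl refl refl) ⟩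
  shape i e d (M₁ ∸ M₂) (suc M₂) ⊖ shape i (2 + 2 * M₂ + e) d (M₁ ∸ M₂) (suc M₂)
    ≈⟨ shape-q2poch-step₂ i e d (M₁ ∸ M₂) M₂ ⟩
  shape i e d (M₁ ∸ M₂) M₂
    ≈⟨ shape-cong (split M₁ M₂) (factor a b M₁ M₂) (d-shift c M₂) refl refl ⟩
  shape (2 + (M₁ + M₂)) (4 + a + b + qExp (4 + a) (4 + b) M₁ M₂) (1 + (2 + c) + 2 * M₂) (M₁ ∸ M₂) M₂
    ≈⟨ x^q^-⊗-shape 2 (4 + a + b) (M₁ + M₂) _ _ (M₁ ∸ M₂) M₂ ⟨
  x^ 2 q^ (4 + a + b) ⊗ summand (4 + a) (4 + b) (2 + c) M₁ M₂
    ∎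
  where
  open ≈-Reasoning
  i = suc M₁ + suc M₂
  e = qExp a b (suc M₁) (suc M₂)
  d = 1 + c + 2 * suc M₂
  raise : ∀ a b M₁ M₂ → 2 + 2 * M₂ + (2 * (suc M₁ * suc M₁ + suc M₂ * suc M₂) + a * suc M₁ + b * suc M₂)
                      ≡ 2 * (suc M₁ * suc M₁ + suc M₂ * suc M₂) + a * suc M₁ + (2 + b) * suc M₂
  raise = ℕ-Solver.solve-∀
  split : ∀ M₁ M₂ → suc M₁ + suc M₂ ≡ 2 + (M₁ + M₂)
  split = ℕ-Solver.solve-∀
  factor : ∀ a b M₁ M₂ → 2 * (suc M₁ * suc M₁ + suc M₂ * suc M₂) + a * suc M₁ + b * suc M₂
                       ≡ 4 + a + b + (2 * (M₁ * M₁ + M₂ * M₂) + (4 + a) * M₁ + (4 + b) * M₂)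
  factor = ℕ-Solver.solve-∀
  d-shift : ∀ c M₂ → 1 + c + 2 * suc M₂ ≡ 1 + (2 + c) + 2 * M₂
  d-shift = ℕ-Solver.solve-∀

summand-β-zero : ∀ a b c N₁ → summand a b c N₁ 0 ≈ summand a (2 + b) c N₁ 0
summand-β-zero a b c N₁ = shape-cong refl (exponent a b N₁) refl refl refl
  where
  exponent : ∀ a b N₁ → 2 * (N₁ * N₁ + 0 * 0) + a * N₁ + b * 0 ≡ 2 * (N₁ * N₁ + 0 * 0) + a * N₁ + (2 + b) * 0
  exponent = ℕ-Solver.solve-∀

summand-γ : ∀ a b c N₂ k → summand a (2 + b) c (suc (N₂ + k)) N₂ ⊖ summand (2 + a) b c (suc (N₂ + k)) N₂
                           ≈ x^ 1 q^ (2 + a) ⊗ summand (4 + a) (2 + b) c (N₂ + k) N₂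
summand-γ a b c N₂ k = begin
  shape i e d k₁ N₂ ⊖ shape i (qExp (2 + a) b (suc (N₂ + k)) N₂) d k₁ N₂
    ≈⟨ ⊖-cong (shape-cong refl refl refl gap refl) (shape-cong refl (sym (raise a b N₂ k)) refl gap refl) ⟩
  shape i e d (suc k) N₂ ⊖ shape i (2 + 2 * k + e) d (suc k) N₂
    ≈⟨ shape-q2poch-step₁ i e d k N₂ ⟩
  shape i e d k N₂
    ≈⟨ shape-cong refl (factor a b N₂ k) refl (sym (ℕₚ.m+n∸m≡n N₂ k)) refl ⟩
  shape (1 + (N₂ + k + N₂)) (2 + a + qExp (4 + a) (2 + b) (N₂ + k) N₂) d (N₂ + k ∸ N₂) N₂
    ≈⟨ x^q^-⊗-shape 1 (2 + a) (N₂ + k + N₂) _ d (N₂ + k ∸ N₂) N₂ ⟨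
  x^ 1 q^ (2 + a) ⊗ summand (4 + a) (2 + b) c (N₂ + k) N₂
    ∎
  where
  open ≈-Reasoning
  i = suc (N₂ + k) + N₂
  e = qExp a (2 + b) (suc (N₂ + k)) N₂
  d = 1 + c + 2 * N₂
  k₁ = suc (N₂ + k) ∸ N₂
  gap : suc (N₂ + k) ∸ N₂ ≡ suc k
  gap = trans (ℕₚ.+-∸-assoc 1 (ℕₚ.m≤m+n N₂ k)) (cong suc (ℕₚ.m+n∸m≡n N₂ k))
  raise : ∀ a b N₂ k → 2 + 2 * k + (2 * (suc (N₂ + k) * suc (N₂ + k) + N₂ * N₂) + a * suc (N₂ + k) + (2 + b) * N₂)
                     ≡ 2 * (suc (N₂ + k) * suc (N₂ + k) + N₂ * N₂) + (2 + a) * suc (N₂ + k) + b * N₂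
  raise = ℕ-Solver.solve-∀
  factor : ∀ a b N₂ k → 2 * (suc (N₂ + k) * suc (N₂ + k) + N₂ * N₂) + a * suc (N₂ + k) + (2 + b) * N₂
                      ≡ 2 + a + (2 * ((N₂ + k) * (N₂ + k) + N₂ * N₂) + (4 + a) * (N₂ + k) + (2 + b) * N₂)
  factor = ℕ-Solver.solve-∀

summand-γ-diagonal : ∀ a b c N → summand a (2 + b) c N N ≈ summand (2 + a) b c N N
summand-γ-diagonal a b c N = shape-cong refl (exponent a b N) refl refl refl
  where
  exponent : ∀ a b N → 2 * (N * N + N * N) + a * N + (2 + b) * N ≡ 2 * (N * N + N * N) + (2 + a) * N + b * N
  exponent = ℕ-Solver.solve-∀

-- Only N₁ ≤ ℓ contributes to the coefficient of x^ℓ, because x^(N₁+N₂) divides the summand.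
R : ℕ → ℕ → ℕ → Series
R a b c ℓ n = Σ△ˢ ℓ (summand a b c) ℓ n

R-truncate : ∀ a b c {K ℓ} n → ℓ ≤ K → Σ△ˢ K (summand a b c) ℓ n ≡ R a b c ℓ n
R-truncate a b c {K} {ℓ} n ℓ≤K = Σ≤-extend _ ℓ≤K λ N₁ ℓ<N₁ _ → Σ≤-zero N₁ λ N₂ _ →
  x^∣summand a b c N₁ N₂ ℓ n (ℕₚ.<-≤-trans ℓ<N₁ (ℕₚ.m≤m+n N₁ N₂))

RHS≈R : RHS ≈ R 0 0 0
RHS≈R .coeff ℓ n = Σ△-cong ℓ λ N₁ N₂ → coeff (term≈summand N₁ N₂) ℓ n

⊗-R : ∀ f a b c ℓ n → (f ⊗ R a b c) ℓ n ≡ Σ△ ℓ (λ N₁ N₂ → (f ⊗ summand a b c N₁ N₂) ℓ n)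
⊗-R f a b c ℓ n =
  trans (⊗-congʳ-≤ f ℓ n λ ℓ′ n′ ℓ′≤ℓ _ → sym (R-truncate a b c n′ ℓ′≤ℓ))
        (coeff (⊗-Σ△ˢ f ℓ (summand a b c)) ℓ n)

σ-R : ∀ a b c → σ (R a b c) ≈ R (2 + a) (2 + b) (2 + c)
σ-R a b c .coeff ℓ n with 2 * ℓ ≤? n
... | yes 2ℓ≤n = Σ△-cong ℓ λ N₁ N₂ →
  trans (sym (σ-yes (summand a b c N₁ N₂) ℓ 2ℓ≤n)) (coeff (σ-summand a b c N₁ N₂) ℓ n)
... | no 2ℓ≰n  = sym (Σ△-zero ℓ λ N₁ N₂ →
  trans (sym (coeff (σ-summand a b c N₁ N₂) ℓ n)) (σ-no (summand a b c N₁ N₂) ℓ (ℕₚ.≰⇒> 2ℓ≰n)))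

R-α : ∀ a b c → R a b c ≈ R a b (2 + c) ⊕ x^ 1 q^ (1 + c) ⊗ R a (2 + b) (2 + c)
R-α a b c .coeff ℓ n = begin
  Σ△ ℓ (λ N₁ N₂ → summand a b c N₁ N₂ ℓ n)
    ≡⟨ Σ△-cong ℓ (λ N₁ N₂ → coeff (summand-α a b c N₁ N₂) ℓ n) ⟩
  Σ△ ℓ (λ N₁ N₂ → summand a b (2 + c) N₁ N₂ ℓ n ℤ.+ (m ⊗ summand a (2 + b) (2 + c) N₁ N₂) ℓ n)
    ≡⟨ Σ△-distrib-+ ℓ _ _ ⟩
  R a b (2 + c) ℓ n ℤ.+ Σ△ ℓ (λ N₁ N₂ → (m ⊗ summand a (2 + b) (2 + c) N₁ N₂) ℓ n)
    ≡⟨ cong (λ v → R a b (2 + c) ℓ n ℤ.+ v) (⊗-R m a (2 + b) (2 + c) ℓ n) ⟨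
  R a b (2 + c) ℓ n ℤ.+ (m ⊗ R a (2 + b) (2 + c)) ℓ n
    ∎
  where
  open ≡-Reasoning
  m = x^ 1 q^ (1 + c)

R-difference : ∀ a b c a′ b′ c′ ℓ n →
               R a b c ℓ n ℤ.- R a′ b′ c′ ℓ n
               ≡ Σ△ (suc ℓ) (λ N₁ N₂ → (summand a b c N₁ N₂ ⊖ summand a′ b′ c′ N₁ N₂) ℓ n)
R-difference a b c a′ b′ c′ ℓ n =
  trans (sym (cong₂ ℤ._-_ (R-truncate a b c n (ℕₚ.n≤1+n ℓ)) (R-truncate a′ b′ c′ n (ℕₚ.n≤1+n ℓ))))
        (sym (Σ△-distrib-- (suc ℓ) _ _))

R-β : ∀ a b c → R a b c ≈ R a (2 + b) c ⊕ x^ 2 q^ (4 + a + b) ⊗ R (4 + a) (4 + b) (2 + c)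
R-β a b c .coeff ℓ n = difference⇒sum (begin
  R a b c ℓ n ℤ.- R a (2 + b) c ℓ n
    ≡⟨ R-difference a b c a (2 + b) c ℓ n ⟩
  Σ△ (suc ℓ) (λ N₁ N₂ → (summand a b c N₁ N₂ ⊖ summand a (2 + b) c N₁ N₂) ℓ n)
    ≡⟨ Σ△-dropColumn ℓ _ (λ N₁ → ≈⇒⊖≡0 (summand-β-zero a b c N₁) ℓ n) ⟩
  Σ△ ℓ (λ M₁ M₂ → (summand a b c (suc M₁) (suc M₂) ⊖ summand a (2 + b) c (suc M₁) (suc M₂)) ℓ n)
    ≡⟨ Σ△-cong ℓ (λ M₁ M₂ → coeff (summand-β a b c M₁ M₂) ℓ n) ⟩
  Σ△ ℓ (λ M₁ M₂ → (m ⊗ summand (4 + a) (4 + b) (2 + c) M₁ M₂) ℓ n)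
    ≡⟨ ⊗-R m (4 + a) (4 + b) (2 + c) ℓ n ⟨
  (m ⊗ R (4 + a) (4 + b) (2 + c)) ℓ n
    ∎)
  where
  open ≡-Reasoning
  m = x^ 2 q^ (4 + a + b)

R-γ : ∀ a b c → R a (2 + b) c ≈ R (2 + a) b c ⊕ x^ 1 q^ (2 + a) ⊗ R (4 + a) (2 + b) c
R-γ a b c .coeff ℓ n = difference⇒sum (begin
  R a (2 + b) c ℓ n ℤ.- R (2 + a) b c ℓ n
    ≡⟨ R-difference a (2 + b) c (2 + a) b c ℓ n ⟩
  Σ△ (suc ℓ) (λ N₁ N₂ → (summand a (2 + b) c N₁ N₂ ⊖ summand (2 + a) b c N₁ N₂) ℓ n)
    ≡⟨ Σ△-dropDiagonal ℓ _ (λ N → ≈⇒⊖≡0 (summand-γ-diagonal a b c N) ℓ n) ⟩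
  Σ△ ℓ (λ M₁ N₂ → (summand a (2 + b) c (suc M₁) N₂ ⊖ summand (2 + a) b c (suc M₁) N₂) ℓ n)
    ≡⟨ Σ△-cong-≤ ℓ (λ M₁ N₂ N₂≤M₁ _ → γ-at N₂≤M₁) ⟩
  Σ△ ℓ (λ M₁ N₂ → (m ⊗ summand (4 + a) (2 + b) c M₁ N₂) ℓ n)
    ≡⟨ ⊗-R m (4 + a) (2 + b) c ℓ n ⟨
  (m ⊗ R (4 + a) (2 + b) c) ℓ n
    ∎)
  where
  open ≡-Reasoning
  m = x^ 1 q^ (2 + a)
  γ-at : ∀ {M₁ N₂} → N₂ ≤ M₁ → (summand a (2 + b) c (suc M₁) N₂ ⊖ summand (2 + a) b c (suc M₁) N₂) ℓ n
                                ≡ (m ⊗ summand (4 + a) (2 + b) c M₁ N₂) ℓ n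
  γ-at {M₁} {N₂} N₂≤M₁ = subst γ-at-row (ℕₚ.m+[n∸m]≡n N₂≤M₁) (coeff (summand-γ a b c N₂ (M₁ ∸ N₂)) ℓ n)
    where
    γ-at-row : ℕ → Set
    γ-at-row M = (summand a (2 + b) c (suc M) N₂ ⊖ summand (2 + a) b c (suc M) N₂) ℓ n
                 ≡ (m ⊗ summand (4 + a) (2 + b) c M N₂) ℓ n

-- The q-difference system

record SolvesSystem (F D : Series) : Set where
  field
    F-eq : F ≈ D ⊕ x^ 1 q^ 1 ⊗ D ⊕ x^ 2 q^ 4 ⊗ σ (σ F)
    D-eq : D ≈ σ F ⊕ x^ 1 q^ 2 ⊗ σ D ⊕ x^ 2 q^ 5 ⊗ σ (σ F)
    F-x⁰ : ∀ n → F 0 n ≡ one 0 n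
    D-x⁰ : ∀ n → D 0 n ≡ one 0 n

RowsBelow : ℕ → Series → Series → Set
RowsBelow ℓ f g = ∀ a b → a < ℓ → f a b ≡ g a b

x^q^-⊗-RowsBelow : ∀ i j {ℓ f g} → 0 < i → RowsBelow ℓ f g → ∀ n → (x^ i q^ j ⊗ f) ℓ n ≡ (x^ i q^ j ⊗ g) ℓ n
x^q^-⊗-RowsBelow i j {ℓ} {f} {g} 0<i f≡g n with i ≤? ℓ | j ≤? n
... | yes i≤ℓ | yes j≤n = begin
  (x^ i q^ j ⊗ f) ℓ n      ≡⟨ coeff (x^q^-⊗ i j f) ℓ n ⟩
  shift i j f ℓ n          ≡⟨ shift-yes i j f i≤ℓ j≤n ⟩
  f (ℓ ∸ i) (n ∸ j)        ≡⟨ f≡g (ℓ ∸ i) (n ∸ j) (ℕₚ.∸-monoʳ-< 0<i i≤ℓ) ⟩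
  g (ℓ ∸ i) (n ∸ j)        ≡⟨ shift-yes i j g i≤ℓ j≤n ⟨
  shift i j g ℓ n          ≡⟨ coeff (x^q^-⊗ i j g) ℓ n ⟨
  (x^ i q^ j ⊗ g) ℓ n      ∎
  where open ≡-Reasoning
... | yes _ | no j≰n = trans (coeff (x^q^-⊗ i j f) ℓ n) (trans (shift-missʳ i j f ℓ (ℕₚ.≰⇒> j≰n))
                         (sym (trans (coeff (x^q^-⊗ i j g) ℓ n) (shift-missʳ i j g ℓ (ℕₚ.≰⇒> j≰n)))))
... | no i≰ℓ | _     = trans (coeff (x^q^-⊗ i j f) ℓ n) (trans (shift-missˡ i j f n (ℕₚ.≰⇒> i≰ℓ))
                         (sym (trans (coeff (x^q^-⊗ i j g) ℓ n) (shift-missˡ i j g n (ℕₚ.≰⇒> i≰ℓ)))))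

σ-RowsBelow : ∀ {ℓ f g} → RowsBelow ℓ f g → RowsBelow ℓ (σ f) (σ g)
σ-RowsBelow {f = f} {g} f≡g a b a<ℓ with 2 * a ≤? b
... | yes _ = f≡g a (b ∸ 2 * a) a<ℓ
... | no _  = refl

σ-row : ∀ {f g} k n → (∀ n′ → n′ < n → f (suc k) n′ ≡ g (suc k) n′) → σ f (suc k) n ≡ σ g (suc k) n
σ-row k n f≡g with 2 * suc k ≤? n
... | yes 2+2k≤n = f≡g (n ∸ 2 * suc k) (ℕₚ.∸-monoʳ-< (s≤s z≤n) 2+2k≤n)
... | no _       = refl

-- Induction on the x-degree, and within a row on the q-degree: in that row the D-equation involves F
-- only through σ F, which lowers the q-degree, and the F-equation involves D only at the same coefficient.
SolvesSystem-unique : ∀ {F D F′ D′} → SolvesSystem F D → SolvesSystem F′ D′ → F ≈ F′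
SolvesSystem-unique {F} {D} {F′} {D′} S S′ .coeff ℓ n = proj₁ (rowsBelow (suc ℓ)) ℓ n ℕₚ.≤-refl
  where
  open SolvesSystem
  Agree : ℕ → Set
  Agree ℓ = RowsBelow ℓ F F′ × RowsBelow ℓ D D′
  row : ∀ ℓ → Agree ℓ → ∀ n → F ℓ n ≡ F′ ℓ n × D ℓ n ≡ D′ ℓ n
  row zero    _             n = trans (F-x⁰ S n) (sym (F-x⁰ S′ n)) , trans (D-x⁰ S n) (sym (D-x⁰ S′ n))
  row (suc k) (F≡F′ , D≡D′) = <-rec _ λ n earlier → F-at n (D-at n earlier) , D-at n earlier
    where
    σσF-below : ∀ j n → (x^ 2 q^ j ⊗ σ (σ F)) (suc k) n ≡ (x^ 2 q^ j ⊗ σ (σ F′)) (suc k) n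
    σσF-below j = x^q^-⊗-RowsBelow 2 j (s≤s z≤n) (σ-RowsBelow (σ-RowsBelow F≡F′))
    D-at : ∀ n → (∀ {n′} → n′ < n → F (suc k) n′ ≡ F′ (suc k) n′ × D (suc k) n′ ≡ D′ (suc k) n′) →
           D (suc k) n ≡ D′ (suc k) n
    D-at n earlier = begin
      D (suc k) n
        ≡⟨ coeff (D-eq S) (suc k) n ⟩
      σ F (suc k) n ℤ.+ (x^ 1 q^ 2 ⊗ σ D) (suc k) n ℤ.+ (x^ 2 q^ 5 ⊗ σ (σ F)) (suc k) n
        ≡⟨ cong₂ ℤ._+_ (cong₂ ℤ._+_ (σ-row k n λ n′ n′<n → proj₁ (earlier n′<n))
                                     (x^q^-⊗-RowsBelow 1 2 (s≤s z≤n) (σ-RowsBelow D≡D′) n))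
                       (σσF-below 5 n) ⟩
      σ F′ (suc k) n ℤ.+ (x^ 1 q^ 2 ⊗ σ D′) (suc k) n ℤ.+ (x^ 2 q^ 5 ⊗ σ (σ F′)) (suc k) n
        ≡⟨ coeff (D-eq S′) (suc k) n ⟨
      D′ (suc k) n
        ∎
      where open ≡-Reasoning
    F-at : ∀ n → D (suc k) n ≡ D′ (suc k) n → F (suc k) n ≡ F′ (suc k) n
    F-at n D≡D′-here = begin
      F (suc k) n
        ≡⟨ coeff (F-eq S) (suc k) n ⟩
      D (suc k) n ℤ.+ (x^ 1 q^ 1 ⊗ D) (suc k) n ℤ.+ (x^ 2 q^ 4 ⊗ σ (σ F)) (suc k) n
        ≡⟨ cong₂ ℤ._+_ (cong₂ ℤ._+_ D≡D′-here (x^q^-⊗-RowsBelow 1 1 (s≤s z≤n) D≡D′ n)) (σσF-below 4 n) ⟩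
      D′ (suc k) n ℤ.+ (x^ 1 q^ 1 ⊗ D′) (suc k) n ℤ.+ (x^ 2 q^ 4 ⊗ σ (σ F′)) (suc k) n
        ≡⟨ coeff (F-eq S′) (suc k) n ⟨
      F′ (suc k) n
        ∎
      where open ≡-Reasoning
  extend : ∀ ℓ {f g} → RowsBelow ℓ f g → (∀ n → f ℓ n ≡ g ℓ n) → RowsBelow (suc ℓ) f g
  extend ℓ f≡g f≡g-here a b a<1+ℓ with ℕₚ.m<1+n⇒m<n∨m≡n a<1+ℓ
  ... | inj₁ a<ℓ  = f≡g a b a<ℓ
  ... | inj₂ refl = f≡g-here b
  rowsBelow : ∀ ℓ → Agree ℓ
  rowsBelow zero    = (λ _ _ ()) , (λ _ _ ())
  rowsBelow (suc ℓ) with rowsBelow ℓ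
  ... | below@(F≡F′ , D≡D′) = extend ℓ F≡F′ (proj₁ ∘ row ℓ below) , extend ℓ D≡D′ (proj₂ ∘ row ℓ below)

σσ-R : σ (σ (R 0 0 0)) ≈ R 4 4 4
σσ-R = ≈-trans (σ-cong (σ-R 0 0 0)) (σ-R 2 2 2)

R-F-eq : R 0 0 0 ≈ R 0 2 2 ⊕ x^ 1 q^ 1 ⊗ R 0 2 2 ⊕ x^ 2 q^ 4 ⊗ σ (σ (R 0 0 0))
R-F-eq = begin
  R 0 0 0                  ≈⟨ R-α 0 0 0 ⟩
  R 0 0 2 ⊕ xqD            ≈⟨ ⊕-congˡ xqD (R-β 0 0 2) ⟩
  D ⊕ x²q⁴R₄₄₄ ⊕ xqD       ≈⟨ ⊕-assoc D x²q⁴R₄₄₄ xqD ⟩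
  D ⊕ (x²q⁴R₄₄₄ ⊕ xqD)     ≈⟨ ⊕-congʳ D (⊕-comm x²q⁴R₄₄₄ xqD) ⟩
  D ⊕ (xqD ⊕ x²q⁴R₄₄₄)     ≈⟨ ⊕-assoc D xqD x²q⁴R₄₄₄ ⟨
  D ⊕ xqD ⊕ x²q⁴R₄₄₄       ≈⟨ ⊕-congʳ (D ⊕ xqD) (⊗-congʳ (x^ 2 q^ 4) σσ-R) ⟨
  D ⊕ xqD ⊕ x^ 2 q^ 4 ⊗ σ (σ (R 0 0 0)) ∎
  where
  open ≈-Reasoning
  D = R 0 2 2
  xqD = x^ 1 q^ 1 ⊗ D
  x²q⁴R₄₄₄ = x^ 2 q^ 4 ⊗ R 4 4 4

-- Both sides exceed the claimed identity by x²q⁷ R 6 6 4.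
R₄₂₂⊕≈R₂₄₄⊕ : R 4 2 2 ⊕ x^ 1 q^ 4 ⊗ R 6 4 4 ≈ R 2 4 4 ⊕ x^ 1 q^ 3 ⊗ R 4 4 4
R₄₂₂⊕≈R₂₄₄⊕ = ⊕-cancelʳ W (begin
  R 4 2 2 ⊕ xq⁴ ⊗ R 6 4 4 ⊕ W               ≈⟨ ⊕-assoc (R 4 2 2) (xq⁴ ⊗ R 6 4 4) W ⟩
  R 4 2 2 ⊕ (xq⁴ ⊗ R 6 4 4 ⊕ W)             ≈⟨ ⊕-congʳ (R 4 2 2) (x^q^-⊗-⊕ 1 4 (R 6 4 4) 1 3 (R 6 6 4)) ⟨
  R 4 2 2 ⊕ xq⁴ ⊗ (R 6 4 4 ⊕ xq³ ⊗ R 6 6 4) ≈⟨ ⊕-congʳ (R 4 2 2) (⊗-congʳ xq⁴ (R-α 6 4 2)) ⟨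
  R 4 2 2 ⊕ xq⁴ ⊗ R 6 4 2                   ≈⟨ R-γ 2 2 2 ⟨
  R 2 4 2                                   ≈⟨ R-α 2 4 2 ⟩
  R 2 4 4 ⊕ xq³ ⊗ R 2 6 4                   ≈⟨ ⊕-congʳ (R 2 4 4) (⊗-congʳ xq³ (R-γ 2 4 4)) ⟩
  R 2 4 4 ⊕ xq³ ⊗ (R 4 4 4 ⊕ xq⁴ ⊗ R 6 6 4) ≈⟨ ⊕-congʳ (R 2 4 4) (x^q^-⊗-⊕ 1 3 (R 4 4 4) 1 4 (R 6 6 4)) ⟩
  R 2 4 4 ⊕ (xq³ ⊗ R 4 4 4 ⊕ W)             ≈⟨ ⊕-assoc (R 2 4 4) (xq³ ⊗ R 4 4 4) W ⟨
  R 2 4 4 ⊕ xq³ ⊗ R 4 4 4 ⊕ W               ∎)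
  where
  open ≈-Reasoning
  xq³ = x^ 1 q^ 3
  xq⁴ = x^ 1 q^ 4
  W = x^ 2 q^ 7 ⊗ R 6 6 4

R-D-eq : R 0 2 2 ≈ σ (R 0 0 0) ⊕ x^ 1 q^ 2 ⊗ σ (R 0 2 2) ⊕ x^ 2 q^ 5 ⊗ σ (σ (R 0 0 0))
R-D-eq = begin
  R 0 2 2                                         ≈⟨ R-γ 0 0 2 ⟩
  R 2 0 2 ⊕ xq² ⊗ R 4 2 2                         ≈⟨ ⊕-congˡ (xq² ⊗ R 4 2 2) (R-β 2 0 2) ⟩
  R 2 2 2 ⊕ x²q⁶R₆₄₄ ⊕ xq² ⊗ R 4 2 2              ≈⟨ ⊕-assoc (R 2 2 2) x²q⁶R₆₄₄ (xq² ⊗ R 4 2 2) ⟩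
  R 2 2 2 ⊕ (x²q⁶R₆₄₄ ⊕ xq² ⊗ R 4 2 2)            ≈⟨ ⊕-congʳ (R 2 2 2) (⊕-comm x²q⁶R₆₄₄ _) ⟩
  R 2 2 2 ⊕ (xq² ⊗ R 4 2 2 ⊕ x²q⁶R₆₄₄)            ≈⟨ ⊕-congʳ (R 2 2 2) (x^q^-⊗-⊕ 1 2 (R 4 2 2) 1 4 (R 6 4 4)) ⟨
  R 2 2 2 ⊕ xq² ⊗ (R 4 2 2 ⊕ x^ 1 q^ 4 ⊗ R 6 4 4) ≈⟨ ⊕-congʳ (R 2 2 2) (⊗-congʳ xq² R₄₂₂⊕≈R₂₄₄⊕) ⟩
  R 2 2 2 ⊕ xq² ⊗ (R 2 4 4 ⊕ x^ 1 q^ 3 ⊗ R 4 4 4) ≈⟨ ⊕-congʳ (R 2 2 2) (x^q^-⊗-⊕ 1 2 (R 2 4 4) 1 3 (R 4 4 4)) ⟩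
  R 2 2 2 ⊕ (xq² ⊗ R 2 4 4 ⊕ x²q⁵R₄₄₄)            ≈⟨ ⊕-assoc (R 2 2 2) (xq² ⊗ R 2 4 4) x²q⁵R₄₄₄ ⟨
  R 2 2 2 ⊕ xq² ⊗ R 2 4 4 ⊕ x²q⁵R₄₄₄
    ≈⟨ ⊕-cong (⊕-cong (σ-R 0 0 0) (⊗-congʳ xq² (σ-R 0 2 2))) (⊗-congʳ (x^ 2 q^ 5) σσ-R) ⟨
  σ (R 0 0 0) ⊕ xq² ⊗ σ (R 0 2 2) ⊕ x^ 2 q^ 5 ⊗ σ (σ (R 0 0 0)) ∎
  where
  open ≈-Reasoning
  xq² = x^ 1 q^ 2
  x²q⁶R₆₄₄ = x^ 2 q^ 6 ⊗ R 6 4 4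
  x²q⁵R₄₄₄ = x^ 2 q^ 5 ⊗ R 4 4 4

X⁰One : Series → Set
X⁰One f = ∀ n → f 0 n ≡ one 0 n

X⁰One-⊗ : ∀ f g → X⁰One f → X⁰One g → X⁰One (f ⊗ g)
X⁰One-⊗ f g f₀ g₀ n =
  trans (Σ≤-cong n λ j → cong₂ ℤ._*_ (f₀ j) (g₀ (n ∸ j))) (coeff (⊗-identityˡ one) 0 n)

X⁰One-Π< : ∀ K f → (∀ i → X⁰One (f i)) → X⁰One (Π< K f)
X⁰One-Π< zero    f f₀ n = refl
X⁰One-Π< (suc K) f f₀ = X⁰One-⊗ (Π< K f) (f K) (X⁰One-Π< K f f₀) (f₀ K)

X⁰One-negxPochInf : ∀ c → X⁰One (negxPochInf c)
X⁰One-negxPochInf c n = X⁰One-Π< (suc n) (negxFactor c) factor₀ n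
  where
  factor₀ : ∀ i → X⁰One (negxFactor c i)
  factor₀ i n = trans (cong (λ v → one 0 n ℤ.+ v) (mono-miss (+ 1) 1 (c + 2 * i) 0 n λ ())) (ℤₚ.+-identityʳ _)

q2poch⁻¹-zero : q2poch⁻¹ 0 ≈ one
q2poch⁻¹-zero = ≈-sym (recip-unique one one refl (⊗-identityˡ one))

R-x⁰ : ∀ a b c → X⁰One (R a b c)
R-x⁰ a b c n = begin
  summand a b c 0 0 0 n
    ≡⟨ coeff (shape-cong refl (exponent a b) refl refl refl) 0 n ⟩
  shape 0 0 d 0 0 0 n
    ≡⟨ coeff (shape-unfold 0 0 d 0 0) 0 n ⟩
  (one ⊗ Q ⊗ q2poch⁻¹ 0 ⊗ q2poch⁻¹ 0) 0 n
    ≡⟨ coeff (⊗-cong (⊗-congʳ (one ⊗ Q) q2poch⁻¹-zero) q2poch⁻¹-zero) 0 n ⟩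
  (one ⊗ Q ⊗ one ⊗ one) 0 n
    ≡⟨ X⁰One-⊗ (one ⊗ Q ⊗ one) one
         (X⁰One-⊗ (one ⊗ Q) one (X⁰One-⊗ one Q (λ _ → refl) (X⁰One-negxPochInf d)) (λ _ → refl))
         (λ _ → refl) n ⟩
  one 0 n
    ∎
  where
  open ≡-Reasoning
  d = 1 + c + 2 * 0
  Q = negxPochInf d
  exponent : ∀ a b → 2 * (0 * 0 + 0 * 0) + a * 0 + b * 0 ≡ 0
  exponent a b = cong₂ _+_ (ℕₚ.*-zeroʳ a) (ℕₚ.*-zeroʳ b)

R-SolvesSystem : SolvesSystem (R 0 0 0) (R 0 2 2)
R-SolvesSystem = record { F-eq = R-F-eq ; D-eq = R-D-eq ; F-x⁰ = R-x⁰ 0 0 0 ; D-x⁰ = R-x⁰ 0 2 2 }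

-- Building partitions from the smallest part

odd : ℕ → Bool
odd zero          = false
odd (suc zero)    = true
odd (suc (suc n)) = odd n

-- Parts are placed smallest first.  State (c , d) means that the last two parts placed were
-- c - 2 ≤ d - 2, with 0 in place of c or d for a part not yet placed.  The next part k must satisfy
-- k ≥ c, strictly if k is even (so k ≥ 1 when c = 0), k ≥ d - 2, and k ≠ d - 2 if d is odd.
-- It is written with _<ᵇ_ and _≡ᵇ_ so that admissible (2 + c) (2 + d) (2 + k) reduces to admissible c d k.
admissible : ℕ → ℕ → ℕ → Bool
admissible c d k = (c <ᵇ suc k) ∧ ((c <ᵇ k) ∨ odd k) ∧ (d <ᵇ 3 + k) ∧ not (odd d ∧ (d ≡ᵇ 2 + k))

guard : Bool → Series → Series
guard b f a n = if b then f a n else 0ℤ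

-- G c d ℓ n counts the ways to place ℓ more parts of total size n, starting in state (c , d).
G : ℕ → ℕ → Series
G c d zero    n = one 0 n
G c d (suc ℓ) n = Σ≤ n λ k → if admissible c d k then G d (2 + k) ℓ (n ∸ k) else 0ℤ

-- firstStep t = Σ_k x q^k t k
firstStep : (ℕ → Series) → Series
firstStep t zero    n = 0ℤ
firstStep t (suc ℓ) n = Σ≤ n λ k → t k ℓ (n ∸ k)

step : ℕ → ℕ → ℕ → Series
step c d k = guard (admissible c d k) (G d (2 + k))

G-unfold : ∀ c d → G c d ≈ one ⊕ firstStep (step c d)
G-unfold c d .coeff zero    n = sym (ℤₚ.+-identityʳ (one 0 n))
G-unfold c d .coeff (suc ℓ) n =
  sym (trans (cong (ℤ._+ G c d (suc ℓ) n) (mono-miss 1ℤ 0 0 (suc ℓ) n λ ())) (ℤₚ.+-identityˡ _))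

firstStep-cong : ∀ {t t′} → (∀ k → t k ≈ t′ k) → firstStep t ≈ firstStep t′
firstStep-cong t≈t′ .coeff zero    n = refl
firstStep-cong t≈t′ .coeff (suc ℓ) n = Σ≤-cong n λ k → coeff (t≈t′ k) ℓ (n ∸ k)

firstStep-⊕-point : ∀ {t t′} k₀ h → t k₀ ≈ t′ k₀ ⊕ h → (∀ k → k ≢ k₀ → t k ≈ t′ k) →
                    firstStep t ≈ firstStep t′ ⊕ x^ 1 q^ k₀ ⊗ h
firstStep-⊕-point {t} {t′} k₀ h at-k₀ elsewhere .coeff zero n =
  sym (trans (cong (ℤ._+_ 0ℤ) (trans (coeff (x^q^-⊗ 1 k₀ h) 0 n) (shift-missˡ 1 k₀ h n (s≤s z≤n)))) refl)
firstStep-⊕-point {t} {t′} k₀ h at-k₀ elsewhere .coeff (suc ℓ) n = begin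
  Σ≤ n (λ k → t k ℓ (n ∸ k))
    ≡⟨ Σ≤-cong n split ⟩
  Σ≤ n (λ k → t′ k ℓ (n ∸ k) ℤ.+ δ k)
    ≡⟨ Σ≤-distrib-+ n _ δ ⟩
  Σ≤ n (λ k → t′ k ℓ (n ∸ k)) ℤ.+ Σ≤ n δ
    ≡⟨ cong (λ v → Σ≤ n (λ k → t′ k ℓ (n ∸ k)) ℤ.+ v) Σδ ⟩
  Σ≤ n (λ k → t′ k ℓ (n ∸ k)) ℤ.+ (x^ 1 q^ k₀ ⊗ h) (suc ℓ) n
    ∎
  where
  open ≡-Reasoning
  δ : ℕ → ℤ
  δ k = t k ℓ (n ∸ k) ℤ.- t′ k ℓ (n ∸ k)
  split : ∀ k → t k ℓ (n ∸ k) ≡ t′ k ℓ (n ∸ k) ℤ.+ δ k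
  split k = restore (t k ℓ (n ∸ k)) (t′ k ℓ (n ∸ k))
    where
    restore : ∀ u v → u ≡ v ℤ.+ (u ℤ.- v)
    restore = solve-∀
  δ-elsewhere : ∀ k → k ≢ k₀ → δ k ≡ 0ℤ
  δ-elsewhere k k≢k₀ = ≈⇒⊖≡0 (elsewhere k k≢k₀) ℓ (n ∸ k)
  δ-k₀ : δ k₀ ≡ h ℓ (n ∸ k₀)
  δ-k₀ = trans (cong (ℤ._- t′ k₀ ℓ (n ∸ k₀)) (coeff at-k₀ ℓ (n ∸ k₀)))
               (cancel (t′ k₀ ℓ (n ∸ k₀)) (h ℓ (n ∸ k₀)))
    where
    cancel : ∀ u v → u ℤ.+ v ℤ.- u ≡ v
    cancel = solve-∀
  Σδ : Σ≤ n δ ≡ (x^ 1 q^ k₀ ⊗ h) (suc ℓ) n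
  Σδ with k₀ ≤? n
  ... | yes k₀≤n = trans (Σ≤-single n k₀ δ k₀≤n δ-elsewhere)
                     (trans δ-k₀ (sym (trans (coeff (x^q^-⊗ 1 k₀ h) (suc ℓ) n) (shift-yes 1 k₀ h (s≤s z≤n) k₀≤n))))
  ... | no k₀≰n  = trans (Σ≤-zero n λ k k≤n → δ-elsewhere k λ { refl → k₀≰n k≤n })
                     (sym (trans (coeff (x^q^-⊗ 1 k₀ h) (suc ℓ) n) (shift-missʳ 1 k₀ h (suc ℓ) (ℕₚ.≰⇒> k₀≰n))))

-- From a shifted state every part is at least 2.
G-shifted-low : ∀ ℓ c d {n} → n < 2 * ℓ → G (2 + c) (2 + d) ℓ n ≡ 0ℤ
G-shifted-low (suc ℓ) c d {n} n<2+2ℓ = Σ≤-zero n λ k k≤n → vanishes k k≤n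
  where
  vanishes : ∀ k → k ≤ n → (if admissible (2 + c) (2 + d) k then G (2 + d) (2 + k) ℓ (n ∸ k) else 0ℤ) ≡ 0ℤ
  vanishes zero          _   = refl
  vanishes (suc zero)    _   = refl
  vanishes (suc (suc j)) k≤n with admissible c d j
  ... | true  = G-shifted-low ℓ d (2 + j) (begin-strict
    n ∸ (2 + j)           ≤⟨ ℕₚ.∸-monoʳ-≤ n (s≤s (s≤s z≤n)) ⟩
    n ∸ 2                 <⟨ ℕₚ.∸-monoˡ-< (ℕₚ.<-≤-trans n<2+2ℓ (ℕₚ.≤-reflexive (ℕₚ.*-suc 2 ℓ)))
                                          (ℕₚ.≤-trans (s≤s (s≤s z≤n)) k≤n) ⟩
    2 + 2 * ℓ ∸ 2         ≡⟨ ℕₚ.m+n∸m≡n 2 (2 * ℓ) ⟩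
    2 * ℓ                 ∎)
    where open ℕₚ.≤-Reasoning
  ... | false = refl

G-shifted : ∀ ℓ m c d → G (2 + c) (2 + d) ℓ (2 * ℓ + m) ≡ G c d ℓ m
G-shifted zero    m c d = refl
G-shifted (suc ℓ) m c d = begin
  Σ≤ (2 * suc ℓ + m) (part (2 * suc ℓ + m))
    ≡⟨ cong (λ N → Σ≤ N (part N)) (cong (_+ m) (ℕₚ.*-suc 2 ℓ)) ⟩
  Σ≤ (2 + (2 * ℓ + m)) (part (2 + (2 * ℓ + m)))
    ≡⟨ Σ≤-shift 2 (2 * ℓ + m) _ (λ { zero _ → refl ; (suc zero) _ → refl ; (suc (suc _)) (s≤s (s≤s ())) }) ⟩
  Σ≤ (2 * ℓ + m) (λ j → if admissible c d j then G (2 + d) (4 + j) ℓ (2 * ℓ + m ∸ j) else 0ℤ)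
    ≡⟨ Σ≤-extend _ (ℕₚ.m≤n+m m (2 * ℓ)) (λ j m<j j≤ → low j (ℕₚ.∸-monoʳ-< m<j j≤)) ⟩
  Σ≤ m (λ j → if admissible c d j then G (2 + d) (4 + j) ℓ (2 * ℓ + m ∸ j) else 0ℤ)
    ≡⟨ Σ≤-cong-≤ m (λ j j≤m → shifted j (ℕₚ.+-∸-assoc (2 * ℓ) j≤m)) ⟩
  Σ≤ m (λ j → if admissible c d j then G d (2 + j) ℓ (m ∸ j) else 0ℤ)
    ∎
  where
  open ≡-Reasoning
  part : ℕ → ℕ → ℤ
  part N k = if admissible (2 + c) (2 + d) k then G (2 + d) (2 + k) ℓ (N ∸ k) else 0ℤ
  low : ∀ j → 2 * ℓ + m ∸ j < 2 * ℓ + m ∸ m →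
        (if admissible c d j then G (2 + d) (4 + j) ℓ (2 * ℓ + m ∸ j) else 0ℤ) ≡ 0ℤ
  low j lt with admissible c d j
  ... | true  = G-shifted-low ℓ d (2 + j) (subst (2 * ℓ + m ∸ j <_) (ℕₚ.m+n∸n≡m (2 * ℓ) m) lt)
  ... | false = refl
  shifted : ∀ j → 2 * ℓ + m ∸ j ≡ 2 * ℓ + (m ∸ j) →
            (if admissible c d j then G (2 + d) (4 + j) ℓ (2 * ℓ + m ∸ j) else 0ℤ)
            ≡ (if admissible c d j then G d (2 + j) ℓ (m ∸ j) else 0ℤ)
  shifted j e with admissible c d j
  ... | true  = trans (cong (G (2 + d) (4 + j) ℓ) e) (G-shifted ℓ (m ∸ j) d (2 + j))
  ... | false = refl

σ-G : ∀ c d → σ (G c d) ≈ G (2 + c) (2 + d)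
σ-G c d .coeff ℓ n with 2 * ℓ ≤? n
... | yes 2ℓ≤n = sym (trans (cong (G (2 + c) (2 + d) ℓ) (sym (ℕₚ.m+[n∸m]≡n 2ℓ≤n))) (G-shifted ℓ (n ∸ 2 * ℓ) c d))
... | no 2ℓ≰n  = sym (G-shifted-low ℓ c d (ℕₚ.≰⇒> 2ℓ≰n))

guard-cong : ∀ {b b′ g g′} → b ≡ b′ → (T b → g ≈ g′) → guard b g ≈ guard b′ g′
guard-cong {true}  refl g≈g′ = record { coeff = coeff (g≈g′ tt) }
guard-cong {false} refl _    = ≈-refl

guard-true-⊕ : ∀ {g} g′ h → g ≈ g′ ⊕ h → guard true g ≈ guard true g′ ⊕ h
guard-true-⊕ g′ h g≈g′⊕h = record { coeff = coeff g≈g′⊕h }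

guard-false-⊕ : ∀ {g h} g′ → g ≈ h → guard true g ≈ guard false g′ ⊕ h
guard-false-⊕ g′ g≈h .coeff a n = trans (coeff g≈h a n) (sym (ℤₚ.+-identityˡ _))

G-cong : ∀ {c d c′ d′} → (∀ k → step c d k ≈ step c′ d′ k) → G c d ≈ G c′ d′
G-cong {c} {d} {c′} {d′} steps≈ = begin
  G c d                                   ≈⟨ G-unfold c d ⟩
  one ⊕ firstStep (step c d)              ≈⟨ ⊕-congʳ one (firstStep-cong steps≈) ⟩
  one ⊕ firstStep (step c′ d′)            ≈⟨ G-unfold c′ d′ ⟨
  G c′ d′                                 ∎
  where open ≈-Reasoning

G-⊕-point : ∀ {c d c′ d′} k₀ h → step c d k₀ ≈ step c′ d′ k₀ ⊕ h →
            (∀ k → k ≢ k₀ → step c d k ≈ step c′ d′ k) →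
            G c d ≈ G c′ d′ ⊕ x^ 1 q^ k₀ ⊗ h
G-⊕-point {c} {d} {c′} {d′} k₀ h at-k₀ elsewhere = begin
  G c d                                               ≈⟨ G-unfold c d ⟩
  one ⊕ firstStep (step c d)                          ≈⟨ ⊕-congʳ one (firstStep-⊕-point k₀ h at-k₀ elsewhere) ⟩
  one ⊕ (firstStep (step c′ d′) ⊕ x^ 1 q^ k₀ ⊗ h)     ≈⟨ ⊕-assoc one (firstStep (step c′ d′)) (x^ 1 q^ k₀ ⊗ h) ⟨
  one ⊕ firstStep (step c′ d′) ⊕ x^ 1 q^ k₀ ⊗ h       ≈⟨ ⊕-congˡ (x^ 1 q^ k₀ ⊗ h) (G-unfold c′ d′) ⟨
  G c′ d′ ⊕ x^ 1 q^ k₀ ⊗ h                            ∎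
  where open ≈-Reasoning

step-cong : ∀ c d c′ d′ k → admissible c d k ≡ admissible c′ d′ k →
            (T (admissible c d k) → G d (2 + k) ≈ G d′ (2 + k)) →
            step c d k ≈ step c′ d′ k
step-cong c d c′ d′ k = guard-cong

G-first : ∀ c c′ d → (∀ k → admissible c d k ≡ admissible c′ d k) → G c d ≈ G c′ d
G-first c c′ d adm≡ = G-cong λ k → step-cong c d c′ d k (adm≡ k) (λ _ → ≈-refl)

adm-3≡adm-2 : ∀ d k → admissible 3 d k ≡ admissible 2 d k
adm-3≡adm-2 d 0 = refl
adm-3≡adm-2 d 1 = refl
adm-3≡adm-2 d 2 = refl
adm-3≡adm-2 d 3 = refl
adm-3≡adm-2 d (suc (suc (suc (suc k)))) = refl

adm-0≡adm-3 : ∀ j k → admissible 0 (5 + j) k ≡ admissible 3 (5 + j) k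
adm-0≡adm-3 j 0 = refl
adm-0≡adm-3 j 1 = refl
adm-0≡adm-3 j 2 = refl
adm-0≡adm-3 j 3 = refl
adm-0≡adm-3 j (suc (suc (suc (suc k)))) = refl

adm-4≡adm-5 : ∀ j k → admissible 4 (6 + j) k ≡ admissible 5 (6 + j) k
adm-4≡adm-5 j 0 = refl
adm-4≡adm-5 j 1 = refl
adm-4≡adm-5 j 2 = refl
adm-4≡adm-5 j 3 = refl
adm-4≡adm-5 j 4 = refl
adm-4≡adm-5 j 5 = refl
adm-4≡adm-5 j (suc (suc (suc (suc (suc (suc k)))))) = refl

G₄₅≈G₄₄ : G 4 5 ≈ G 4 4
G₄₅≈G₄₄ = G-cong λ k → step-cong 4 5 4 4 k (adm k) (continuation k)
  where
  adm : ∀ k → admissible 4 5 k ≡ admissible 4 4 k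
  adm 0 = refl
  adm 1 = refl
  adm 2 = refl
  adm 3 = refl
  adm 4 = refl
  adm (suc (suc (suc (suc (suc k))))) = refl
  continuation : ∀ k → T (admissible 4 5 k) → G 5 (2 + k) ≈ G 4 (2 + k)
  continuation (suc (suc (suc (suc (suc k))))) _ = ≈-sym (G-first 4 5 (7 + k) (adm-4≡adm-5 (1 + k)))

G₀₄≈G₃₄⊕ : G 0 4 ≈ G 3 4 ⊕ x^ 1 q^ 2 ⊗ G 4 4
G₀₄≈G₃₄⊕ = G-⊕-point 2 (G 4 4) (guard-false-⊕ (G 4 4) ≈-refl) λ k k≢2 →
  step-cong 0 4 3 4 k (adm k k≢2) (λ _ → ≈-refl)
  where
  adm : ∀ k → k ≢ 2 → admissible 0 4 k ≡ admissible 3 4 k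
  adm 0 _ = refl
  adm 1 _ = refl
  adm 2 2≢2 = ⊥-elim (2≢2 refl)
  adm 3 _ = refl
  adm (suc (suc (suc (suc k)))) _ = refl

G₃₄≈G₂₅⊕ : G 3 4 ≈ G 2 5 ⊕ x^ 1 q^ 3 ⊗ G 4 4
G₃₄≈G₂₅⊕ = G-⊕-point 3 (G 4 4) (guard-false-⊕ (G 5 5) G₄₅≈G₄₄) λ k k≢3 →
  step-cong 3 4 2 5 k (adm k k≢3) (continuation k k≢3)
  where
  adm : ∀ k → k ≢ 3 → admissible 3 4 k ≡ admissible 2 5 k
  adm 0 _ = refl
  adm 1 _ = refl
  adm 2 _ = refl
  adm 3 3≢3 = ⊥-elim (3≢3 refl)
  adm (suc (suc (suc (suc k)))) _ = refl
  continuation : ∀ k → k ≢ 3 → T (admissible 3 4 k) → G 4 (2 + k) ≈ G 5 (2 + k)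
  continuation 3 3≢3 _ = ⊥-elim (3≢3 refl)
  continuation (suc (suc (suc (suc k)))) _ _ = G-first 4 5 (6 + k) (adm-4≡adm-5 k)

G₀₃≈G₂₂⊕ : G 0 3 ≈ G 2 2 ⊕ x^ 1 q^ 2 ⊗ G 3 4
G₀₃≈G₂₂⊕ = G-⊕-point 2 (G 3 4) (guard-false-⊕ (G 2 4) ≈-refl) λ k k≢2 →
  step-cong 0 3 2 2 k (adm k k≢2) (λ _ → G-first 3 2 (2 + k) (adm-3≡adm-2 (2 + k)))
  where
  adm : ∀ k → k ≢ 2 → admissible 0 3 k ≡ admissible 2 2 k
  adm 0 _ = refl
  adm 1 _ = refl
  adm 2 2≢2 = ⊥-elim (2≢2 refl)
  adm (suc (suc (suc k))) _ = refl

-- The intermediate family has the admissibility of state (0 , 3) but the continuations of state (0 , 0).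
G₀₀≈G₀₃⊕ : G 0 0 ≈ G 0 3 ⊕ x^ 1 q^ 1 ⊗ G 0 3 ⊕ x^ 2 q^ 4 ⊗ G 4 4
G₀₀≈G₀₃⊕ = begin
  G 0 0
    ≈⟨ G-unfold 0 0 ⟩
  one ⊕ firstStep (step 0 0)
    ≈⟨ ⊕-congʳ one (firstStep-⊕-point 1 (G 0 3) (guard-false-⊕ (G 0 3) ≈-refl) at≢1) ⟩
  one ⊕ (firstStep t ⊕ xqG₀₃)
    ≈⟨ ⊕-congʳ one (⊕-congˡ xqG₀₃ (firstStep-⊕-point 2 xq²G₄₄ (guard-true-⊕ (G 3 4) xq²G₄₄ G₀₄≈G₃₄⊕)
                                                   at≢2)) ⟩
  one ⊕ (firstStep (step 0 3) ⊕ x^ 1 q^ 2 ⊗ xq²G₄₄ ⊕ xqG₀₃)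
    ≈⟨ ⊕-congʳ one (⊕-congˡ xqG₀₃ (⊕-congʳ (firstStep (step 0 3)) x^q^-twice)) ⟩
  one ⊕ (firstStep (step 0 3) ⊕ x²q⁴G₄₄ ⊕ xqG₀₃)
    ≈⟨ regroup one (firstStep (step 0 3)) x²q⁴G₄₄ xqG₀₃ ⟩
  one ⊕ firstStep (step 0 3) ⊕ xqG₀₃ ⊕ x²q⁴G₄₄
    ≈⟨ ⊕-congˡ x²q⁴G₄₄ (⊕-congˡ xqG₀₃ (G-unfold 0 3)) ⟨
  G 0 3 ⊕ xqG₀₃ ⊕ x²q⁴G₄₄
    ∎
  where
  open ≈-Reasoning
  xqG₀₃ = x^ 1 q^ 1 ⊗ G 0 3
  xq²G₄₄ = x^ 1 q^ 2 ⊗ G 4 4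
  x²q⁴G₄₄ = x^ 2 q^ 4 ⊗ G 4 4
  t : ℕ → Series
  t k = guard (admissible 0 3 k) (G 0 (2 + k))
  at≢1 : ∀ k → k ≢ 1 → step 0 0 k ≈ t k
  at≢1 0 _ = ≈-refl
  at≢1 1 1≢1 = ⊥-elim (1≢1 refl)
  at≢1 (suc (suc k)) _ = ≈-refl
  at≢2 : ∀ k → k ≢ 2 → t k ≈ step 0 3 k
  at≢2 0 _ = ≈-refl
  at≢2 1 _ = ≈-refl
  at≢2 2 2≢2 = ⊥-elim (2≢2 refl)
  at≢2 (suc (suc (suc j))) _ = guard-cong refl λ _ → G-first 0 3 (5 + j) (adm-0≡adm-3 j)
  x^q^-twice : x^ 1 q^ 2 ⊗ xq²G₄₄ ≈ x²q⁴G₄₄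
  x^q^-twice = ≈-trans (≈-sym (⊗-assoc (x^ 1 q^ 2) (x^ 1 q^ 2) (G 4 4))) (⊗-congˡ (G 4 4) (x^q^-⊗-x^q^ 1 2 1 2))
  regroup : ∀ A B C D → A ⊕ (B ⊕ C ⊕ D) ≈ A ⊕ B ⊕ D ⊕ C
  regroup A B C D .coeff ℓ n = shuffle (A ℓ n) (B ℓ n) (C ℓ n) (D ℓ n)
    where
    shuffle : ∀ a b c d → a ℤ.+ (b ℤ.+ c ℤ.+ d) ≡ a ℤ.+ b ℤ.+ d ℤ.+ c
    shuffle = solve-∀

σσ-G : σ (σ (G 0 0)) ≈ G 4 4
σσ-G = ≈-trans (σ-cong (σ-G 0 0)) (σ-G 2 2)

G-F-eq : G 0 0 ≈ G 0 3 ⊕ x^ 1 q^ 1 ⊗ G 0 3 ⊕ x^ 2 q^ 4 ⊗ σ (σ (G 0 0))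
G-F-eq = ≈-trans G₀₀≈G₀₃⊕ (⊕-congʳ (G 0 3 ⊕ x^ 1 q^ 1 ⊗ G 0 3) (⊗-congʳ (x^ 2 q^ 4) (≈-sym σσ-G)))

G-D-eq : G 0 3 ≈ σ (G 0 0) ⊕ x^ 1 q^ 2 ⊗ σ (G 0 3) ⊕ x^ 2 q^ 5 ⊗ σ (σ (G 0 0))
G-D-eq = begin
  G 0 3                                              ≈⟨ G₀₃≈G₂₂⊕ ⟩
  G 2 2 ⊕ xq² ⊗ G 3 4                                ≈⟨ ⊕-congʳ (G 2 2) (⊗-congʳ xq² G₃₄≈G₂₅⊕) ⟩
  G 2 2 ⊕ xq² ⊗ (G 2 5 ⊕ x^ 1 q^ 3 ⊗ G 4 4)          ≈⟨ ⊕-congʳ (G 2 2) (x^q^-⊗-⊕ 1 2 (G 2 5) 1 3 (G 4 4)) ⟩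
  G 2 2 ⊕ (xq² ⊗ G 2 5 ⊕ x²q⁵G₄₄)                    ≈⟨ ⊕-assoc (G 2 2) (xq² ⊗ G 2 5) x²q⁵G₄₄ ⟨
  G 2 2 ⊕ xq² ⊗ G 2 5 ⊕ x²q⁵G₄₄
    ≈⟨ ⊕-cong (⊕-cong (σ-G 0 0) (⊗-congʳ xq² (σ-G 0 3))) (⊗-congʳ (x^ 2 q^ 5) σσ-G) ⟨
  σ (G 0 0) ⊕ xq² ⊗ σ (G 0 3) ⊕ x^ 2 q^ 5 ⊗ σ (σ (G 0 0)) ∎
  where
  open ≈-Reasoning
  xq² = x^ 1 q^ 2
  x²q⁵G₄₄ = x^ 2 q^ 5 ⊗ G 4 4

G-SolvesSystem : SolvesSystem (G 0 0) (G 0 3)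
G-SolvesSystem = record { F-eq = G-F-eq ; D-eq = G-D-eq ; F-x⁰ = λ _ → refl ; D-x⁰ = λ _ → refl }

-- Counting admissible vectors

count : {A : Set} → (A → Bool) → List A → ℤ
count p []       = 0ℤ
count p (x ∷ xs) = (if p x then 1ℤ else 0ℤ) ℤ.+ count p xs

length-filter≡count : {A : Set} {P : A → Set} (P? : ∀ x → Dec (P x)) (xs : List A) →
                      + length (filter P? xs) ≡ count (does ∘ P?) xs
length-filter≡count P? []       = refl
length-filter≡count P? (x ∷ xs) with does (P? x)
... | true  = cong (λ v → 1ℤ ℤ.+ v) (length-filter≡count P? xs)
... | false = trans (length-filter≡count P? xs) (sym (ℤₚ.+-identityˡ _))

count-cong : {A : Set} {p q : A → Bool} → (∀ x → p x ≡ q x) → ∀ xs → count p xs ≡ count q xs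
count-cong p≡q []       = refl
count-cong p≡q (x ∷ xs) = cong₂ (λ b c → (if b then 1ℤ else 0ℤ) ℤ.+ c) (p≡q x) (count-cong p≡q xs)

count-false : {A : Set} (xs : List A) → count (λ _ → false) xs ≡ 0ℤ
count-false []       = refl
count-false (x ∷ xs) = trans (ℤₚ.+-identityˡ _) (count-false xs)

count-∧ : {A : Set} (b : Bool) (q : A → Bool) (xs : List A) → count (λ x → b ∧ q x) xs ≡ (if b then count q xs else 0ℤ)
count-∧ true  q xs = refl
count-∧ false q xs = count-false xs

count-++ : {A : Set} (p : A → Bool) (xs ys : List A) → count p (xs ++ ys) ≡ count p xs ℤ.+ count p ys
count-++ p []       ys = sym (ℤₚ.+-identityˡ _)
count-++ p (x ∷ xs) ys =
  trans (cong (λ v → (if p x then 1ℤ else 0ℤ) ℤ.+ v) (count-++ p xs ys))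
        (sym (ℤₚ.+-assoc (if p x then 1ℤ else 0ℤ) (count p xs) (count p ys)))

count-map : {A B : Set} (p : B → Bool) (f : A → B) (xs : List A) → count p (List.map f xs) ≡ count (p ∘ f) xs
count-map p f []       = refl
count-map p f (x ∷ xs) = cong (λ v → (if p (f x) then 1ℤ else 0ℤ) ℤ.+ v) (count-map p f xs)

count-concatMap-applyUpTo : {A : Set} (p : A → Bool) (f : ℕ → List A) (g : ℕ → ℕ) (n : ℕ) →
                            count p (concatMap f (applyUpTo g (suc n))) ≡ Σ≤ n (λ k → count p (f (g k)))
count-concatMap-applyUpTo p f g zero    = trans (count-++ p (f (g 0)) []) (ℤₚ.+-identityʳ _)
count-concatMap-applyUpTo p f g (suc n) = begin
  count p (f (g 0) ++ concatMap f (applyUpTo (g ∘ suc) (suc n)))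
    ≡⟨ count-++ p (f (g 0)) _ ⟩
  count p (f (g 0)) ℤ.+ count p (concatMap f (applyUpTo (g ∘ suc) (suc n)))
    ≡⟨ cong (λ v → count p (f (g 0)) ℤ.+ v) (count-concatMap-applyUpTo p f (g ∘ suc) n) ⟩
  count p (f (g 0)) ℤ.+ Σ≤ n (λ k → count p (f (g (suc k))))
    ≡⟨ Σ≤-suc n (λ k → count p (f (g k))) ⟨
  Σ≤ (suc n) (λ k → count p (f (g k)))
    ∎
  where open ≡-Reasoning

count-vecsUpTo-∷ : ∀ ℓ m (p : Vec ℕ (suc ℓ) → Bool) →
                   count p (vecsUpTo (suc ℓ) m) ≡ Σ≤ m (λ k → count (λ v → p (k ∷ v)) (vecsUpTo ℓ m))
count-vecsUpTo-∷ ℓ m p =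
  trans (count-concatMap-applyUpTo p (λ k → List.map (k ∷_) (vecsUpTo ℓ m)) id m)
        (Σ≤-cong m λ k → count-map p (k ∷_) (vecsUpTo ℓ m))

count-vecsUpTo-∷ʳ : ∀ ℓ m (p : Vec ℕ (suc ℓ) → Bool) →
                    count p (vecsUpTo (suc ℓ) m) ≡ Σ≤ m (λ k → count (λ v → p (v ∷ʳ k)) (vecsUpTo ℓ m))
count-vecsUpTo-∷ʳ zero    m p = count-vecsUpTo-∷ zero m p
count-vecsUpTo-∷ʳ (suc ℓ) m p = begin
  count p (vecsUpTo (2 + ℓ) m)
    ≡⟨ count-vecsUpTo-∷ (suc ℓ) m p ⟩
  Σ≤ m (λ a → count (λ v → p (a ∷ v)) (vecsUpTo (suc ℓ) m))
    ≡⟨ Σ≤-cong m (λ a → count-vecsUpTo-∷ʳ ℓ m (λ v → p (a ∷ v))) ⟩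
  Σ≤ m (λ a → Σ≤ m λ k → count (λ v → p ((a ∷ v) ∷ʳ k)) (vecsUpTo ℓ m))
    ≡⟨ Σ≤-comm m m _ ⟩
  Σ≤ m (λ k → Σ≤ m λ a → count (λ v → p ((a ∷ v) ∷ʳ k)) (vecsUpTo ℓ m))
    ≡⟨ Σ≤-cong m (λ k → count-vecsUpTo-∷ ℓ m (λ v → p (v ∷ʳ k))) ⟨
  Σ≤ m (λ k → count (λ v → p (v ∷ʳ k)) (vecsUpTo (suc ℓ) m))
    ∎
  where open ≡-Reasoning

-- The state reached from (c , d) after placing the parts of v, smallest (last) first.
stateAfter : ∀ {ℓ} → ℕ → ℕ → Vec ℕ ℓ → ℕ × ℕ
stateAfter c d []          = c , d
stateAfter c d (y ∷ [])    = d , 2 + y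
stateAfter c d (y ∷ z ∷ _) = 2 + z , 2 + y

stateAfter-∷ʳ : ∀ {ℓ} c d k (v : Vec ℕ ℓ) → stateAfter c d (v ∷ʳ k) ≡ stateAfter d (2 + k) v
stateAfter-∷ʳ c d k []          = refl
stateAfter-∷ʳ c d k (y ∷ [])    = refl
stateAfter-∷ʳ c d k (y ∷ z ∷ v) = refl

admissibleAfter : ∀ {ℓ} → ℕ → ℕ → Vec ℕ ℓ → ℕ → Bool
admissibleAfter c d v = admissible (proj₁ (stateAfter c d v)) (proj₂ (stateAfter c d v))

AdmissibleFrom : ∀ {ℓ} → ℕ → ℕ → Vec ℕ ℓ → Bool
AdmissibleFrom c d []      = true
AdmissibleFrom c d (x ∷ v) = admissibleAfter c d v x ∧ AdmissibleFrom c d v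

AdmissibleFrom-∷ʳ : ∀ {ℓ} c d k (v : Vec ℕ ℓ) →
                    AdmissibleFrom c d (v ∷ʳ k) ≡ admissible c d k ∧ AdmissibleFrom d (2 + k) v
AdmissibleFrom-∷ʳ c d k []      = refl
AdmissibleFrom-∷ʳ c d k (x ∷ v) = begin
  admissibleAfter c d (v ∷ʳ k) x ∧ AdmissibleFrom c d (v ∷ʳ k)
    ≡⟨ cong₂ _∧_ (cong (λ s → admissible (proj₁ s) (proj₂ s) x) (stateAfter-∷ʳ c d k v))
                 (AdmissibleFrom-∷ʳ c d k v) ⟩
  admissibleAfter d (2 + k) v x ∧ (admissible c d k ∧ AdmissibleFrom d (2 + k) v)
    ≡⟨ ∧-swap (admissibleAfter d (2 + k) v x) (admissible c d k) _ ⟩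
  admissible c d k ∧ (admissibleAfter d (2 + k) v x ∧ AdmissibleFrom d (2 + k) v)
    ∎
  where
  open ≡-Reasoning
  ∧-swap : ∀ x y z → x ∧ (y ∧ z) ≡ y ∧ (x ∧ z)
  ∧-swap true  y z = refl
  ∧-swap false y z = sym (Boolₚ.∧-zeroʳ y)

sum-∷ʳ : ∀ {ℓ} (v : Vec ℕ ℓ) k → Vec.sum (v ∷ʳ k) ≡ k + Vec.sum v
sum-∷ʳ []      k = refl
sum-∷ʳ (x ∷ v) k = trans (cong (λ s → x + s) (sum-∷ʳ v k)) (x∙yz≈y∙xz x k (Vec.sum v))

+-≡ᵇ-+ : ∀ k s t → (k + s ≡ᵇ k + t) ≡ (s ≡ᵇ t)
+-≡ᵇ-+ zero    s t = refl
+-≡ᵇ-+ (suc k) s t = +-≡ᵇ-+ k s t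

>-≡ᵇ : ∀ k s {n} → n < k → (k + s ≡ᵇ n) ≡ false
>-≡ᵇ k s {n} n<k with k + s ≡ᵇ n in eq
... | true  = ⊥-elim (ℕₚ.<⇒≱ n<k (subst (k ≤_) (ℕₚ.≡ᵇ⇒≡ (k + s) n (subst T (sym eq) _)) (ℕₚ.m≤m+n k s)))
... | false = refl

Counted : ∀ {ℓ} → ℕ → ℕ → ℕ → Vec ℕ ℓ → Bool
Counted c d n v = AdmissibleFrom c d v ∧ (Vec.sum v ≡ᵇ n)

Counted-∷ʳ : ∀ {ℓ} c d n k (u : Vec ℕ ℓ) →
             Counted c d n (u ∷ʳ k) ≡ admissible c d k ∧ (AdmissibleFrom d (2 + k) u ∧ (k + Vec.sum u ≡ᵇ n))
Counted-∷ʳ c d n k u =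
  trans (cong₂ _∧_ (AdmissibleFrom-∷ʳ c d k u) (cong (_≡ᵇ n) (sum-∷ʳ u k))) (Boolₚ.∧-assoc (admissible c d k) _ _)

count-Counted≡G : ∀ ℓ m c d n → n ≤ m → count (Counted c d n) (vecsUpTo ℓ m) ≡ G c d ℓ n
count-Counted≡G zero    m c d zero    _ = refl
count-Counted≡G zero    m c d (suc n) _ = refl
count-Counted≡G (suc ℓ) m c d n n≤m = begin
  count (Counted c d n) (vecsUpTo (suc ℓ) m)
    ≡⟨ count-vecsUpTo-∷ʳ ℓ m (Counted c d n) ⟩
  Σ≤ m (λ k → count (λ u → Counted c d n (u ∷ʳ k)) (vecsUpTo ℓ m))
    ≡⟨ Σ≤-extend _ n≤m (λ k n<k _ → trans (count-cong (too-big n<k) (vecsUpTo ℓ m)) (count-false (vecsUpTo ℓ m))) ⟩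
  Σ≤ n (λ k → count (λ u → Counted c d n (u ∷ʳ k)) (vecsUpTo ℓ m))
    ≡⟨ Σ≤-cong-≤ n (λ k k≤n →
         trans (count-cong (fits k≤n) (vecsUpTo ℓ m)) (count-∧ (admissible c d k) _ (vecsUpTo ℓ m))) ⟩
  Σ≤ n (λ k → if admissible c d k then count (Counted d (2 + k) (n ∸ k)) (vecsUpTo ℓ m) else 0ℤ)
    ≡⟨ Σ≤-cong-≤ n (λ k k≤n →
         if-cong (admissible c d k) (count-Counted≡G ℓ m d (2 + k) (n ∸ k) (ℕₚ.≤-trans (ℕₚ.m∸n≤m n k) n≤m))) ⟩
  Σ≤ n (λ k → if admissible c d k then G d (2 + k) ℓ (n ∸ k) else 0ℤ)
    ∎
  where
  open ≡-Reasoning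
  too-big : ∀ {k} → n < k → ∀ u → Counted c d n (u ∷ʳ k) ≡ false
  too-big {k} n<k u = trans (Counted-∷ʳ c d n k u)
    (trans (cong (λ b → admissible c d k ∧ (AdmissibleFrom d (2 + k) u ∧ b)) (>-≡ᵇ k (Vec.sum u) n<k))
           (trans (cong (admissible c d k ∧_) (Boolₚ.∧-zeroʳ _)) (Boolₚ.∧-zeroʳ _)))
  fits : ∀ {k} → k ≤ n → ∀ u → Counted c d n (u ∷ʳ k) ≡ admissible c d k ∧ Counted d (2 + k) (n ∸ k) u
  fits {k} k≤n u = trans (Counted-∷ʳ c d n k u)
    (cong (λ b → admissible c d k ∧ (AdmissibleFrom d (2 + k) u ∧ b))
          (trans (cong (k + Vec.sum u ≡ᵇ_) (sym (ℕₚ.m+[n∸m]≡n k≤n))) (+-≡ᵇ-+ k (Vec.sum u) (n ∸ k))))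
  if-cong : ∀ b {x y} → x ≡ y → (if b then x else 0ℤ) ≡ (if b then y else 0ℤ)
  if-cong b refl = refl

-- The conditions defining B(1;2,3,3;ℓ,n)

odd⇒∤ : ∀ x → T (odd x) → ¬ 2 ∣ x
odd⇒∤ x odd-x (divides q refl) = even-q*2 q odd-x
  where
  even-q*2 : ∀ q → ¬ T (odd (q * 2))
  even-q*2 (suc q) = even-q*2 q

¬odd⇒∣ : ∀ x → ¬ T (odd x) → 2 ∣ x
¬odd⇒∣ zero          _      = divides 0 refl
¬odd⇒∣ (suc zero)    ¬odd-1 = ⊥-elim (¬odd-1 _)
¬odd⇒∣ (suc (suc x)) ¬odd-x with ¬odd⇒∣ x ¬odd-x
... | divides q refl = divides (suc q) refl

T-not⇒¬T : ∀ b → T (not b) → ¬ T b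
T-not⇒¬T false _ ()

¬T⇒T-not : ∀ b → ¬ T b → T (not b)
¬T⇒T-not true  ¬t = ¬t _
¬T⇒T-not false _  = _

record Admissible (c d k : ℕ) : Set where
  field
    c≤k        : c ≤ k
    c<k⊎odd    : c < k ⊎ T (odd k)
    d≤2+k      : d ≤ 2 + k
    no-odd-rep : ¬ (T (odd d) × d ≡ 2 + k)

admissible⇔Admissible : ∀ c d k → T (admissible c d k) ⇔ Admissible c d k
admissible⇔Admissible c d k = mk⇔ decode encode
  where
  open Equivalence using (to; from)
  rep : Bool
  rep = odd d ∧ (d ≡ᵇ 2 + k)
  rep⇔ : T rep ⇔ (T (odd d) × d ≡ 2 + k)
  rep⇔ = mk⇔ (λ t → let (o , e) = to Boolₚ.T-∧ t in o , ℕₚ.≡ᵇ⇒≡ d (2 + k) e)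
             (λ (o , e) → from Boolₚ.T-∧ (o , ℕₚ.≡⇒≡ᵇ d (2 + k) e))
  decode : T (admissible c d k) → Admissible c d k
  decode t with to Boolₚ.T-∧ t
  ... | c≤k , t′ with to Boolₚ.T-∧ t′
  ... | c<k∨odd , t″ with to Boolₚ.T-∧ t″
  ... | d≤2+k , no-rep = record
    { c≤k        = ℕₚ.≤-pred (ℕₚ.<ᵇ⇒< c (suc k) c≤k)
    ; c<k⊎odd    = map₁ (ℕₚ.<ᵇ⇒< c k) (to Boolₚ.T-∨ c<k∨odd)
    ; d≤2+k      = ℕₚ.≤-pred (ℕₚ.<ᵇ⇒< d (3 + k) d≤2+k)
    ; no-odd-rep = T-not⇒¬T rep no-rep ∘ from rep⇔ }
  encode : Admissible c d k → T (admissible c d k)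
  encode A = from Boolₚ.T-∧ (ℕₚ.<⇒<ᵇ (s≤s c≤k) , from Boolₚ.T-∧
             (from Boolₚ.T-∨ (map₁ ℕₚ.<⇒<ᵇ c<k⊎odd) , from Boolₚ.T-∧
             (ℕₚ.<⇒<ᵇ (s≤s d≤2+k) , ¬T⇒T-not rep (no-odd-rep ∘ to rep⇔))))
    where open Admissible A

module _ {ℓ : ℕ} (π : Vec ℕ ℓ) where
  Positive NonIncreasing OddPartsDistinct Gap2 : Set
  Positive         = ∀ i → 1 ≤ lookup π i
  NonIncreasing    = ∀ (i j : Fin ℓ) → toℕ i < toℕ j → lookup π j ≤ lookup π i
  OddPartsDistinct = ∀ (i j : Fin ℓ) → i ≢ j → lookup π i ≡ lookup π j → 2 ∣ lookup π i
  Gap2             = ∀ (i j : Fin ℓ) → toℕ j ≡ toℕ i + 2 →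
                       (lookup π j + 2 ≤ lookup π i) × (2 ∣ lookup π i → lookup π j + 2 < lookup π i)

Local : ∀ {ℓ} → Vec ℕ ℓ → Set
Local π = Positive π × NonIncreasing π × OddPartsDistinct π × Gap2 π

Local-tail : ∀ {ℓ} x (v : Vec ℕ ℓ) → Local (x ∷ v) → Local v
Local-tail x v (pos , ni , od , gap) =
  (pos ∘ suc) , (λ i j i<j → ni (suc i) (suc j) (s≤s i<j)) ,
  (λ i j i≢j → od (suc i) (suc j) (i≢j ∘ Finₚ.suc-injective)) , (λ i j j≡i+2 → gap (suc i) (suc j) (cong suc j≡i+2))

AdmissibleAfter : ∀ {ℓ} → Vec ℕ ℓ → ℕ → Set
AdmissibleAfter v x = Admissible (proj₁ (stateAfter 0 0 v)) (proj₂ (stateAfter 0 0 v)) x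

2+-injective : ∀ {m n} → 2 + m ≡ 2 + n → m ≡ n
2+-injective refl = refl

no-odd-repeat : ∀ {ℓ} x y (w : Vec ℕ ℓ) → OddPartsDistinct (x ∷ y ∷ w) → ¬ (T (odd (2 + y)) × 2 + y ≡ 2 + x)
no-odd-repeat x y w od (odd-y , 2+y≡2+x) =
  odd⇒∤ y odd-y (subst (2 ∣_) (sym y≡x) (od zero (suc zero) (λ ()) (sym y≡x)))
  where
  y≡x = 2+-injective 2+y≡2+x

Local⇒AdmissibleAfter : ∀ {ℓ} x (v : Vec ℕ ℓ) → Local (x ∷ v) → AdmissibleAfter v x
Local⇒AdmissibleAfter x [] (pos , _) = record
  { c≤k = z≤n ; c<k⊎odd = inj₁ (pos zero) ; d≤2+k = z≤n ; no-odd-rep = λ { (() , _) } }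
Local⇒AdmissibleAfter x (y ∷ []) (pos , ni , od , _) = record
  { c≤k = z≤n ; c<k⊎odd = inj₁ (pos zero) ; d≤2+k = s≤s (s≤s (ni zero (suc zero) (s≤s z≤n)))
  ; no-odd-rep = no-odd-repeat x y [] od }
Local⇒AdmissibleAfter x (y ∷ z ∷ w) (pos , ni , od , gap) = record
  { c≤k = subst (_≤ x) (ℕₚ.+-comm z 2) z+2≤x
  ; c<k⊎odd = parity
  ; d≤2+k = s≤s (s≤s (ni zero (suc zero) (s≤s z≤n)))
  ; no-odd-rep = no-odd-repeat x y (z ∷ w) od }
  where
  z+2≤x = proj₁ (gap zero (suc (suc zero)) refl)
  parity : 2 + z < x ⊎ T (odd x)
  parity with odd x in odd-x
  ... | true  = inj₂ _
  ... | false = inj₁ (subst (_< x) (ℕₚ.+-comm z 2)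
                  (proj₂ (gap zero (suc (suc zero)) refl) (¬odd⇒∣ x (λ t → subst T odd-x t))))

Admissible-positive : ∀ {c d k} → Admissible c d k → 1 ≤ k
Admissible-positive {k = zero}  record { c<k⊎odd = inj₁ () }
Admissible-positive {k = zero}  record { c<k⊎odd = inj₂ () }
Admissible-positive {k = suc k} _ = s≤s z≤n

Admissible-previous : ∀ {c x y} → Admissible c (2 + y) x → y ≤ x × ¬ (T (odd y) × y ≡ x)
Admissible-previous A =
  ℕₚ.≤-pred (ℕₚ.≤-pred (Admissible.d≤2+k A)) , λ (o , e) → Admissible.no-odd-rep A (o , cong (λ m → 2 + m) e)

AdmissibleAfter-∷ : ∀ {ℓ} x y (w : Vec ℕ ℓ) → AdmissibleAfter (y ∷ w) x → y ≤ x × ¬ (T (odd y) × y ≡ x)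
AdmissibleAfter-∷ x y []      = Admissible-previous
AdmissibleAfter-∷ x y (_ ∷ _) = Admissible-previous

AdmissibleAfter-∷-∷ : ∀ {ℓ} x y z (w : Vec ℕ ℓ) → AdmissibleAfter (y ∷ z ∷ w) x → z + 2 ≤ x × (2 ∣ x → z + 2 < x)
AdmissibleAfter-∷-∷ x y z w A = subst (_≤ x) (ℕₚ.+-comm 2 z) c≤k , strict
  where
  open Admissible A
  strict : 2 ∣ x → z + 2 < x
  strict 2∣x with c<k⊎odd
  ... | inj₁ 2+z<x = subst (_< x) (ℕₚ.+-comm 2 z) 2+z<x
  ... | inj₂ odd-x = ⊥-elim (odd⇒∤ x odd-x 2∣x)

below-head : ∀ {ℓ} x (v : Vec ℕ ℓ) → AdmissibleAfter v x → NonIncreasing v → ∀ j → lookup v j ≤ x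
below-head x (y ∷ w) A ni zero    = proj₁ (AdmissibleAfter-∷ x y w A)
below-head x (y ∷ w) A ni (suc j) = ℕₚ.≤-trans (ni zero (suc j) (s≤s z≤n)) (proj₁ (AdmissibleAfter-∷ x y w A))

equal-part-even : ∀ {ℓ} x (v : Vec ℕ ℓ) → AdmissibleAfter v x → NonIncreasing v → ∀ j → x ≡ lookup v j → 2 ∣ x
equal-part-even x (y ∷ w) A ni zero x≡y with odd y in odd-y
... | true  = ⊥-elim (proj₂ (AdmissibleAfter-∷ x y w A) (subst T (sym odd-y) _ , sym x≡y))
... | false = subst (2 ∣_) (sym x≡y) (¬odd⇒∣ y (λ t → subst T odd-y t))
equal-part-even x (y ∷ z ∷ w) A ni (suc j) x≡ = ⊥-elim (ℕₚ.<-irrefl refl (begin-strict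
  x                   ≡⟨ x≡ ⟩
  lookup (z ∷ w) j    ≤⟨ below-second j ⟩
  z                   <⟨ ℕₚ.m<m+n z (s≤s z≤n) ⟩
  z + 2               ≤⟨ proj₁ (AdmissibleAfter-∷-∷ x y z w A) ⟩
  x                   ∎))
  where
  open ℕₚ.≤-Reasoning
  below-second : ∀ j → lookup (z ∷ w) j ≤ z
  below-second zero    = ℕₚ.≤-refl
  below-second (suc j) = ni (suc zero) (suc (suc j)) (s≤s (s≤s z≤n))

gap-head : ∀ {ℓ} x (v : Vec ℕ ℓ) → AdmissibleAfter v x → ∀ j → toℕ j ≡ 2 →
           (lookup (x ∷ v) j + 2 ≤ x) × (2 ∣ x → lookup (x ∷ v) j + 2 < x)
gap-head x (y ∷ z ∷ w) A (suc (suc zero)) refl = AdmissibleAfter-∷-∷ x y z w A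
gap-head x []          A zero ()
gap-head x (y ∷ [])    A zero ()
gap-head x (y ∷ [])    A (suc zero) ()
gap-head x (y ∷ z ∷ w) A zero ()
gap-head x (y ∷ z ∷ w) A (suc zero) ()
gap-head x (y ∷ z ∷ w) A (suc (suc (suc j))) ()

Local-∷ : ∀ {ℓ} x (v : Vec ℕ ℓ) → AdmissibleAfter v x → Local v → Local (x ∷ v)
Local-∷ x v A (pos , ni , od , gap) = pos′ , ni′ , od′ , gap′
  where
  pos′ : Positive (x ∷ v)
  pos′ zero    = Admissible-positive A
  pos′ (suc i) = pos i
  ni′ : NonIncreasing (x ∷ v)
  ni′ zero    (suc j) _         = below-head x v A ni j
  ni′ (suc i) (suc j) (s≤s i<j) = ni i j i<j
  od′ : OddPartsDistinct (x ∷ v)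
  od′ zero    zero    0≢0 _   = ⊥-elim (0≢0 refl)
  od′ zero    (suc j) _   x≡  = equal-part-even x v A ni j x≡
  od′ (suc i) zero    _   ≡x  = subst (2 ∣_) (sym ≡x) (equal-part-even x v A ni i (sym ≡x))
  od′ (suc i) (suc j) i≢j e   = od i j (i≢j ∘ cong suc) e
  gap′ : Gap2 (x ∷ v)
  gap′ zero    j       j≡2     = gap-head x v A j j≡2
  gap′ (suc i) (suc j) j≡i+3   = gap i j (ℕₚ.suc-injective j≡i+3)

Local⇔AdmissibleFrom : ∀ {ℓ} (π : Vec ℕ ℓ) → Local π ⇔ T (AdmissibleFrom 0 0 π)
Local⇔AdmissibleFrom π = mk⇔ (to π) (from π)
  where
  to : ∀ {ℓ} (π : Vec ℕ ℓ) → Local π → T (AdmissibleFrom 0 0 π)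
  to []      _ = _
  to (x ∷ v) L = Equivalence.from Boolₚ.T-∧
    (Equivalence.from (admissible⇔Admissible _ _ x) (Local⇒AdmissibleAfter x v L) , to v (Local-tail x v L))
  from : ∀ {ℓ} (π : Vec ℕ ℓ) → T (AdmissibleFrom 0 0 π) → Local π
  from []      _ = (λ ()) , (λ ()) , (λ ()) , (λ ())
  from (x ∷ v) t with Equivalence.to Boolₚ.T-∧ t
  ... | head , tail = Local-∷ x v (Equivalence.to (admissible⇔Admissible _ _ x) head) (from v tail)

-- Only the two smallest parts can be ≤ 2: every other part exceeds a positive part by at least 2.
Local⇒fewSmallParts : ∀ {ℓ} (π : Vec ℕ ℓ) → Local π → length (filter (_≤? 2) (toList π)) ≤ 2
Local⇒fewSmallParts []          _ = z≤n
Local⇒fewSmallParts (x ∷ [])    _ = ℕₚ.m≤n⇒m≤1+n (Listₚ.length-filter (_≤? 2) (toList (x ∷ [])))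
Local⇒fewSmallParts (x ∷ y ∷ []) _ = Listₚ.length-filter (_≤? 2) (toList (x ∷ y ∷ []))
Local⇒fewSmallParts (x ∷ y ∷ z ∷ w) L@(pos , _ , _ , gap) =
  subst (λ xs → length xs ≤ 2) (sym (Listₚ.filter-reject (_≤? 2) x≰2)) (Local⇒fewSmallParts (y ∷ z ∷ w) (Local-tail x _ L))
  where
  x≰2 : ¬ x ≤ 2
  x≰2 x≤2 = ℕₚ.<⇒≱ (ℕₚ.+-monoˡ-≤ 2 (pos (suc (suc zero))))
                    (ℕₚ.≤-trans (proj₁ (gap zero (suc (suc zero)) refl)) x≤2)

IsB⇔Counted : ∀ {ℓ} n (π : Vec ℕ ℓ) → IsB n π ⇔ T (Counted 0 0 n π)
IsB⇔Counted n π = mk⇔ to from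
  where
  open Equivalence (Local⇔AdmissibleFrom π) renaming (to to admissible-from; from to local)
  to : IsB n π → T (Counted 0 0 n π)
  to ((pos , ni , sum≡n) , (od , gap , _)) =
    Equivalence.from Boolₚ.T-∧ (admissible-from (pos , ni , od , gap) , ℕₚ.≡⇒≡ᵇ _ n sum≡n)
  from : T (Counted 0 0 n π) → IsB n π
  from t with Equivalence.to Boolₚ.T-∧ t
  ... | adm , sum≡ᵇn with local adm
  ... | L@(pos , ni , od , gap) = (pos , ni , ℕₚ.≡ᵇ⇒≡ _ n sum≡ᵇn) , (od , gap , Local⇒fewSmallParts π L)

isB?≡Counted : ∀ {ℓ} n (π : Vec ℕ ℓ) → does (isB? n π) ≡ Counted 0 0 n π
isB?≡Counted n π = Reflects.det (proof (isB? n π)) (Reflects.fromEquivalence (from (IsB⇔Counted n π)) (to (IsB⇔Counted n π)))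
  where open Equivalence

B≡G : ∀ ℓ n → + B ℓ n ≡ G 0 0 ℓ n
B≡G ℓ n = begin
  + B ℓ n                                          ≡⟨ length-filter≡count (isB? n) (vecsUpTo ℓ n) ⟩
  count (does ∘ isB? n) (vecsUpTo ℓ n)             ≡⟨ count-cong (isB?≡Counted n) (vecsUpTo ℓ n) ⟩
  count (Counted 0 0 n) (vecsUpTo ℓ n)             ≡⟨ count-Counted≡G ℓ n 0 0 n ℕₚ.≤-refl ⟩
  G 0 0 ℓ n                                        ∎
  where open ≡-Reasoning

theorem1p6 : ∀ (ℓ n : ℕ) → + (B ℓ n) ≡ RHS ℓ n
theorem1p6 ℓ n = begin
  + B ℓ n        ≡⟨ B≡G ℓ n ⟩
  G 0 0 ℓ n      ≡⟨ coeff (SolvesSystem-unique G-SolvesSystem R-SolvesSystem) ℓ n ⟩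
  R 0 0 0 ℓ n    ≡⟨ coeff RHS≈R ℓ n ⟨
  RHS ℓ n        ∎
  where open ≡-Reasoning
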